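{- For all $m>n$, there is an $\mathrm{R}^0(\mathrm{lin})$ refutation of $\neg\mathrm{PHP}^m_n$ of size polynomial in $n$.
   Context: Linear equations $\vec a\cdot\vec x=a_0$ have integer coefficients, size $\sum|a_i|$ (unary). Disjunctions of linear equations: satisfied iff some equation holds; empty disjunction false; size = total size. Clause $\bigvee_{i\in I}x_i\vee\bigvee_{j\in J}\neg x_j$ translates to $\bigvee_{i\in I}(x_i=1)\vee\bigvee_{j\in J}(x_j=0)$. R(lin) proofs: sequences of disjunctions, each initial, a Boolean axiom $(x_h=0)\vee(x_h=1)$, or derived by Resolution (from $A\vee L_1$, $B\vee L_2$ derive $A\vee B\vee(L_1\pm L_2)$), Weakening (from $A$ derive $A\vee L$), Simplification (from $A\vee(0=k)$, $k\ne0$, derive $A$); refutation = proof of the empty disjunction. An $\mathrm{R}^0(\mathrm{lin})$-line is a disjunction of linear equations whose variable coefficients are integers bounded by a fixed constant (free terms unbounded), partitionable into a constant number of sub-disjunctions each consisting of equations differing only in free terms or being a translated clause; $\mathrm{R}^0(\mathrm{lin})$ = R(lin) with only such lines. $\neg\mathrm{PHP}^m_n$ has variables $x_{i,j}$ ($i\in[m]$, $j\in[n]$) and consists of: pigeon axioms $(x_{i,1}=1)\vee\dots\vee(x_{i,n}=1)$ for all $i\in[m]$; hole axioms $(x_{i,k}=0)\vee(x_{j,k}=0)$ for all $1\le i<j\le m$, $k\in[n]$. -}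

module Defs where

open import Data.Nat as ℕ using (ℕ; _≤_; _+_; _*_)
open import Data.Integer as ℤ using (ℤ; ∣_∣; 0ℤ; 1ℤ)
open import Data.Fin as F using (Fin; combine)
open import Data.Vec as V using (Vec; replicate; zipWith; _[_]≔_; lookup)
open import Data.List as L using (List; []; _∷_; _++_; concat; length; map; allFin)
open import Data.Nat.ListAction as LA using ()
open import Data.List.Membership.Propositional using (_∈_)
open import Data.List.Relation.Unary.All using (All)
open import Data.List.Relation.Binary.Permutation.Propositional using (_↭_)
open import Data.Product using (Σ; ∃; ∃-syntax; _×_; _,_)
open import Data.Sum using (_⊎_)
open import Relation.Binary.PropositionalEquality using (_≡_; _≢_)

-- Linear equations over N variables x_0 … x_{N-1}:  a⃗ · x⃗ = a₀

record Eqn (N : ℕ) : Set where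
  constructor _≐_
  field
    coeffs : Vec ℤ N
    free   : ℤ
open Eqn public

infix 4 _≐_

eqnSize : ∀ {N} → Eqn N → ℕ
eqnSize e = V.sum (V.map ∣_∣ (coeffs e)) + ∣ free e ∣

-- a disjunction of linear equations (empty list = empty disjunction = false)
Line : ℕ → Set
Line N = List (Eqn N)

lineSize : ∀ {N} → Line N → ℕ
lineSize C = LA.sum (map eqnSize C)

_≈_ : ∀ {N} → Line N → Line N → Set
A ≈ B = (∀ {e} → e ∈ A → e ∈ B) × (∀ {e} → e ∈ B → e ∈ A)

zeroVec : ∀ {N} → Vec ℤ N
zeroVec {N} = replicate N 0ℤ

unit : ∀ {N} → Fin N → Vec ℤ N
unit h = zeroVec [ h ]≔ 1ℤ

_⊕_ : ∀ {N} → Eqn N → Eqn N → Eqn N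
(a ≐ a₀) ⊕ (b ≐ b₀) = zipWith ℤ._+_ a b ≐ a₀ ℤ.+ b₀

_⊖_ : ∀ {N} → Eqn N → Eqn N → Eqn N
(a ≐ a₀) ⊖ (b ≐ b₀) = zipWith ℤ._-_ a b ≐ a₀ ℤ.- b₀

data Justified {N : ℕ} (Ax : Line N → Set) (prev : List (Line N)) : Line N → Set where
  initial        : ∀ {C D} → Ax D → C ≈ D → Justified Ax prev C
  boolean        : ∀ {C} (h : Fin N) →
                   C ≈ ((unit h ≐ 0ℤ) ∷ (unit h ≐ 1ℤ) ∷ []) → Justified Ax prev C
  resolution+    : ∀ {C D₁ D₂ A B L₁ L₂} → D₁ ∈ prev → D₂ ∈ prev →
                   D₁ ≈ (L₁ ∷ A) → D₂ ≈ (L₂ ∷ B) →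
                   C ≈ ((L₁ ⊕ L₂) ∷ (A ++ B)) → Justified Ax prev C
  resolution-    : ∀ {C D₁ D₂ A B L₁ L₂} → D₁ ∈ prev → D₂ ∈ prev →
                   D₁ ≈ (L₁ ∷ A) → D₂ ≈ (L₂ ∷ B) →
                   C ≈ ((L₁ ⊖ L₂) ∷ (A ++ B)) → Justified Ax prev C
  weakening      : ∀ {C D L} → D ∈ prev → C ≈ (L ∷ D) → Justified Ax prev C
  simplification : ∀ {C D A} (k : ℤ) → k ≢ 0ℤ → D ∈ prev →
                   D ≈ ((zeroVec ≐ k) ∷ A) → C ≈ A → Justified Ax prev C

-- a derivation; the list of lines is stored last-line-first
data Derivation {N : ℕ} (Ax : Line N → Set) : List (Line N) → Set where
  []  : Derivation Ax []
  _▷_ : ∀ {prev C} → Derivation Ax prev → Justified Ax prev C → Derivation Ax (C ∷ prev)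

Refutation : ∀ {N} → (Line N → Set) → List (Line N) → Set
Refutation Ax lines = Σ (List _) λ rest → lines ≡ [] ∷ rest × Derivation Ax lines

proofSize : ∀ {N} → List (Line N) → ℕ
proofSize lines = LA.sum (map lineSize lines)

IsLiteral : ∀ {N} → Eqn N → Set
IsLiteral {N} e = ∃[ h ] (e ≡ (unit h ≐ 0ℤ) ⊎ e ≡ (unit h ≐ 1ℤ))

-- a sub-disjunction: equations differing only in free terms, or a translated clause
GoodPart : ∀ {N} → Line N → Set
GoodPart {N} P = (∃[ a ] All (λ e → coeffs e ≡ a) P) ⊎ All IsLiteral P

R0Line : ∀ {N} → ℕ → ℕ → Line N → Set
R0Line B K C =
  (∀ {e} → e ∈ C → ∀ i → ∣ lookup (coeffs e) i ∣ ≤ B) ×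
  (∃[ parts ] (concat parts ↭ C × length parts ≤ K × All GoodPart parts))

var : ∀ {m n} → Fin m → Fin n → Vec ℤ (m * n)
var i j = unit (combine i j)

data PHP (m n : ℕ) : Line (m * n) → Set where
  pigeon : (i : Fin m) → PHP m n (map (λ j → var i j ≐ 1ℤ) (allFin n))
  hole   : {i j : Fin m} (k : Fin n) → i F.< j →
           PHP m n ((var i k ≐ 0ℤ) ∷ (var j k ≐ 0ℤ) ∷ [])

module Submission where

-- Every line has the
-- form "v ∈ I ∨ R": the equations v = c for all c in an interval I, for a 0/1 coefficient vector v, together
-- with a few further equations R. Resolving two such lines pairwise adds both the vectors and the intervals.
-- For a hole k, the hole axioms give Σ_{i ≤ n} x_{i,k} ∈ {0, 1}; adding over the n holes, the total
-- T = Σ_{i ≤ n, k < n} x_{i,k} lies in [0, n]. For a pigeon i, its pigeon axiom and Boolean axioms give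
-- Σ_k x_{i,k} ∈ [1, n]; adding over the n + 1 pigeons, T lies in [n + 1, (n + 1) n]. Subtracting these two
-- lines pairwise leaves only equations 0 = c with c ≠ 0, which simplification removes one at a time. Every
-- line has at most 8 sub-disjunctions and O(n⁴) equations of size O(n²), and there are O(n⁷) lines.

open import Defs
open import Algebra.Properties.CommutativeSemigroup as CSProps using ()
open import Data.Bool using (true; false; _∧_; if_then_else_)
open import Data.Nat as ℕ using (ℕ; zero; suc; _≤_; _<_; _+_; _*_; _^_; _∸_; z≤n; s≤s; _≤?_; _<?_)
import Data.Nat.Properties as ℕP
open import Data.Nat.Tactic.RingSolver using (solve-∀)
open import Data.Integer as ℤ using (ℤ; ∣_∣; 0ℤ; 1ℤ)
import Data.Integer.Properties as ℤP
open import Data.Fin as F using (Fin; toℕ; fromℕ<; combine; remQuot)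
import Data.Fin.Properties as FP
open import Data.Vec as V using (Vec; []; _∷_; lookup; tabulate; zipWith)
import Data.Vec.Properties as VP
open import Data.List
  using (List; []; _∷_; _++_; map; length; concat; reverse; _ʳ++_; applyUpTo; allFin; cartesianProductWith)
import Data.List.Properties as LP
open import Data.List.Membership.Propositional using (_∈_)
open import Data.List.Membership.Propositional.Properties
  using (∈-++⁻; ∈-++⁺ˡ; ∈-++⁺ʳ; ∈-map⁺; ∈-map⁻; ∈-allFin; ∈-applyUpTo⁺; ∈-applyUpTo⁻;
         ∈-cartesianProductWith⁺; ∈-cartesianProductWith⁻)
open import Data.List.Relation.Unary.Any using (here; there)
open import Data.List.Relation.Unary.All as All using (All; []; _∷_)
import Data.List.Relation.Unary.All.Properties as AllP
open import Data.List.Relation.Binary.Subset.Propositional using (_⊆_)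
open import Data.List.Relation.Binary.Subset.Propositional.Properties
  using (⊆-refl; ⊆-reflexive-↭; xs⊆xs++ys; xs⊆ys++xs)
import Data.List.Relation.Binary.Subset.Propositional.Properties as ⊆P
open import Data.List.Relation.Binary.Permutation.Propositional
  using (_↭_; ↭-refl; ↭-sym; ↭-trans; ↭-reflexive)
import Data.List.Relation.Binary.Permutation.Propositional.Properties as ↭P
open import Data.Product using (Σ; ∃-syntax; _×_; _,_; proj₁; proj₂)
open import Data.Sum using (inj₁; inj₂; [_,_]′)
open import Relation.Nullary using (yes; no; does; contradiction)
open import Relation.Nullary.Decidable using (dec-true; dec-false)
open import Relation.Binary.Definitions using (tri<; tri≈; tri>)
open import Relation.Binary.PropositionalEquality

open CSProps ℕP.+-commutativeSemigroup using () renaming (interchange to +-interchange)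
open CSProps ℕP.*-commutativeSemigroup using () renaming (interchange to *-interchange)

private variable
  N k k₁ k₂ l l₁ l₂ : ℕ
  X Y Z : Line N

≈-refl : X ≈ X
≈-refl = (λ p → p) , (λ p → p)

≈-sym : X ≈ Y → Y ≈ X
≈-sym (f , g) = g , f

≈-trans : X ≈ Y → Y ≈ Z → X ≈ Z
≈-trans (f , g) (h , k) = (λ p → h (f p)) , (λ p → g (k p))

↭⇒≈ : X ↭ Y → X ≈ Y
↭⇒≈ p = ⊆-reflexive-↭ p , ⊆-reflexive-↭ (↭-sym p)

≡⇒≈ : X ≡ Y → X ≈ Y
≡⇒≈ refl = ≈-refl

++⁺ˡ-≈ : ∀ (W : Line N) → X ≈ Y → (W ++ X) ≈ (W ++ Y)
++⁺ˡ-≈ W (f , g) = ⊆P.++⁺ʳ W f , ⊆P.++⁺ʳ W g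

++⁺ʳ-≈ : ∀ (W : Line N) → X ≈ Y → (X ++ W) ≈ (Y ++ W)
++⁺ʳ-≈ W (f , g) = ⊆P.++⁺ˡ W f , ⊆P.++⁺ˡ W g

++-absorbʳ : Y ⊆ X → (X ++ Y) ≈ X
++-absorbʳ {X = X} Y⊆X = (λ p → [ (λ q → q) , Y⊆X ]′ (∈-++⁻ X p)) , xs⊆xs++ys X _

++-duplicateˡ : (X ++ (X ++ Y)) ≈ (X ++ Y)
++-duplicateˡ {X = X} {Y = Y} = ≈-trans (↭⇒≈ (↭P.++-comm X (X ++ Y))) (++-absorbʳ (xs⊆xs++ys X Y))

absorb-swap : ∀ {F R Y : Line N} → Y ⊆ R → (F ++ R) ≈ (R ++ (F ++ Y))
absorb-swap {F = F} {R = R} {Y = Y} Y⊆R = to , from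
  where
  to : F ++ R ⊆ R ++ (F ++ Y)
  to p with ∈-++⁻ F p
  ... | inj₁ q = ∈-++⁺ʳ R (∈-++⁺ˡ q)
  ... | inj₂ q = ∈-++⁺ˡ q
  from : R ++ (F ++ Y) ⊆ F ++ R
  from p with ∈-++⁻ R p
  ... | inj₁ q = ∈-++⁺ʳ F q
  ... | inj₂ q with ∈-++⁻ F q
  ...   | inj₁ r = ∈-++⁺ˡ r
  ...   | inj₂ r = ∈-++⁺ʳ F (Y⊆R r)

module _ {a b c} {A : Set a} {B : Set b} {C : Set c} (f : A → B → C) where

  cartesianProductWith-⊆ : ∀ {xs xs′ ys ys′} → xs ⊆ xs′ → ys ⊆ ys′ →
                           cartesianProductWith f xs ys ⊆ cartesianProductWith f xs′ ys′
  cartesianProductWith-⊆ {xs} {ys = ys} xs⊆ ys⊆ p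
    with x , y , x∈ , y∈ , refl ← ∈-cartesianProductWith⁻ f xs ys p =
    ∈-cartesianProductWith⁺ f (xs⊆ x∈) (ys⊆ y∈)

  length-cartesianProductWith : ∀ xs ys → length (cartesianProductWith f xs ys) ≡ length xs * length ys
  length-cartesianProductWith []       ys = refl
  length-cartesianProductWith (x ∷ xs) ys = begin
    length (map (f x) ys ++ cartesianProductWith f xs ys)   ≡⟨ LP.length-++ (map (f x) ys) ⟩
    length (map (f x) ys) + length (cartesianProductWith f xs ys)
      ≡⟨ cong₂ _+_ (LP.length-map (f x) ys) (length-cartesianProductWith xs ys) ⟩
    length ys + length xs * length ys                       ∎
    where open ≡-Reasoning

record Shaped (OK : Eqn N → Set) (k l : ℕ) (X : Line N) : Set where
  field
    all-ok     : All OK X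
    short      : length X ≤ l
    parts      : List (Line N)
    concat-↭   : concat parts ↭ X
    few-parts  : length parts ≤ k
    good-parts : All GoodPart parts

module _ {OK : Eqn N → Set} where

  shaped-[] : Shaped OK k l []
  shaped-[] = record { all-ok = [] ; short = z≤n ; parts = [] ; concat-↭ = ↭-refl
                     ; few-parts = z≤n ; good-parts = [] }

  shaped-++ : Shaped OK k₁ l₁ X → Shaped OK k₂ l₂ Y → Shaped OK (k₁ + k₂) (l₁ + l₂) (X ++ Y)
  shaped-++ {X = X} {Y = Y} sx sy = record
    { all-ok     = AllP.++⁺ (all-ok sx) (all-ok sy)
    ; short      = subst (_≤ _) (sym (LP.length-++ X)) (ℕP.+-mono-≤ (short sx) (short sy))
    ; parts      = parts sx ++ parts sy
    ; concat-↭   = ↭-trans (↭-reflexive (sym (LP.concat-++ (parts sx) (parts sy))))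
                           (↭P.++⁺ (concat-↭ sx) (concat-↭ sy))
    ; few-parts  = subst (_≤ _) (sym (LP.length-++ (parts sx))) (ℕP.+-mono-≤ (few-parts sx) (few-parts sy))
    ; good-parts = AllP.++⁺ (good-parts sx) (good-parts sy)
    }
    where open Shaped

  shaped-mono : k₁ ≤ k₂ → l₁ ≤ l₂ → Shaped OK k₁ l₁ X → Shaped OK k₂ l₂ X
  shaped-mono k≤ l≤ sx = record
    { all-ok = all-ok ; short = ℕP.≤-trans short l≤ ; parts = parts ; concat-↭ = concat-↭
    ; few-parts = ℕP.≤-trans few-parts k≤ ; good-parts = good-parts }
    where open Shaped sx

  private
    shaped-part : All OK X → GoodPart X → Shaped OK 1 (length X) X
    shaped-part {X = X} ok good = record
      { all-ok = ok ; short = ℕP.≤-refl ; parts = X ∷ [] ; concat-↭ = ↭-reflexive (LP.++-identityʳ X)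
      ; few-parts = s≤s z≤n ; good-parts = good ∷ [] }

  shaped-block : (a : Vec ℤ N) → All OK X → All (λ e → coeffs e ≡ a) X → Shaped OK 1 (length X) X
  shaped-block a ok same = shaped-part ok (inj₁ (a , same))

  shaped-eqs : (a : Vec ℤ N) (xs : List ℤ) → (∀ {x} → x ∈ xs → OK (a ≐ x)) →
               Shaped OK 1 (length xs) (map (a ≐_) xs)
  shaped-eqs a xs ok = shaped-mono ℕP.≤-refl (ℕP.≤-reflexive (LP.length-map (a ≐_) xs))
    (shaped-block a (AllP.map⁺ (All.tabulate ok)) (AllP.map⁺ (All.universal (λ _ → refl) xs)))

  shaped-clause : All OK X → All IsLiteral X → Shaped OK 1 (length X) X
  shaped-clause ok lits = shaped-part ok (inj₂ lits)

-- Extending derivations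

_∈≈_ : Line N → List (Line N) → Set
X ∈≈ π = ∃[ D ] (D ∈ π × D ≈ X)

∈≈-mono : ∀ {π π′ : List (Line N)} → π ⊆ π′ → X ∈≈ π → X ∈≈ π′
∈≈-mono π⊆ (D , D∈ , D≈) = D , π⊆ D∈ , D≈

∈≈-resp-≈ : ∀ {π : List (Line N)} → X ≈ Y → X ∈≈ π → Y ∈≈ π
∈≈-resp-≈ X≈Y (D , D∈ , D≈) = D , D∈ , ≈-trans D≈ X≈Y

∈≈-++[]⁺ : ∀ {π : List (Line N)} → X ∈≈ π → (X ++ []) ∈≈ π
∈≈-++[]⁺ {X = X} = ∈≈-resp-≈ (≡⇒≈ (sym (LP.++-identityʳ X)))

∈≈-++[]⁻ : ∀ {π : List (Line N)} → (X ++ []) ∈≈ π → X ∈≈ π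
∈≈-++[]⁻ {X = X} = ∈≈-resp-≈ (≡⇒≈ (LP.++-identityʳ X))

module Extension {N : ℕ} (Ax : Line N → Set) (Good : Line N → Set) where

  record Extends (k : ℕ) (π : List (Line N)) (Q : List (Line N) → Set) : Set where
    constructor extends
    field
      run : Derivation Ax π →
            Σ (List (Line N)) λ new → length new ≤ k × All Good new × Derivation Ax (new ++ π) × Q (new ++ π)
  open Extends public

  private variable
    π : List (Line N)
    P Q : List (Line N) → Set

  return : Q π → Extends 0 π Q
  return q = extends λ d → [] , z≤n , [] , d , q

  bind : Extends k₁ π P → (∀ {π′} → π ⊆ π′ → P π′ → Extends k₂ π′ Q) → Extends (k₁ + k₂) π Q
  bind {k₁ = k₁} {π = π} {k₂ = k₂} {Q = Q} e f = extends λ d →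
    let new₁ , len₁ , good₁ , d₁ , p₁ = run e d
        new₂ , len₂ , good₂ , d₂ , q₂ = run (f (xs⊆ys++xs π new₁) p₁) d₁
        reassoc = sym (LP.++-assoc new₂ new₁ π)
    in new₂ ++ new₁ ,
       subst₂ _≤_ (sym (LP.length-++ new₂)) (ℕP.+-comm k₂ k₁) (ℕP.+-mono-≤ len₂ len₁) ,
       AllP.++⁺ good₂ good₁ ,
       subst (Derivation Ax) reassoc d₂ , subst Q reassoc q₂

  fmap⊆ : Extends k π P → (∀ {π′} → π ⊆ π′ → P π′ → Q π′) → Extends k π Q
  fmap⊆ {π = π} e f = extends λ d →
    let new , len , good , d′ , p = run e d in new , len , good , d′ , f (xs⊆ys++xs π new) p

  fmap : (∀ {π} → P π → Q π) → Extends k π P → Extends k π Q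
  fmap f e = fmap⊆ e (λ _ → f)

  relax : k₁ ≤ k₂ → Extends k₁ π Q → Extends k₂ π Q
  relax k≤ e = extends λ d → let new , len , rest = run e d in new , ℕP.≤-trans len k≤ , rest

  derive-last : ∀ {C} → Justified Ax π C → Good C → Extends 1 π (λ π′ → ∃[ π″ ] (π′ ≡ C ∷ π″))
  derive-last {π = π} j good = extends λ d → _ ∷ [] , s≤s z≤n , good ∷ [] , d ▷ j , π , refl

  derive : ∀ {C} → Justified Ax π C → Good C → Extends 1 π (C ∈≈_)
  derive {C = C} j good = fmap (λ { (_ , refl) → C , here refl , ≈-refl }) (derive-last j good)

-- Resolving two disjunctions pairwise

data Sign : Set where
  plus minus : Sign

module _ {N : ℕ} where

  infixl 6 _⟨_⟩_
  _⟨_⟩_ : Eqn N → Sign → Eqn N → Eqn N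
  e ⟨ plus ⟩ f = e ⊕ f
  e ⟨ minus ⟩ f = e ⊖ f

  pairwise : Sign → Vec ℤ N → Vec ℤ N → List ℤ → List ℤ → Line N
  pairwise s U V A B = cartesianProductWith (λ b a → (U ≐ a) ⟨ s ⟩ (V ≐ b)) B A

  length-pairwise : ∀ s U V (A B : List ℤ) → length (pairwise s U V A B) ≡ length B * length A
  length-pairwise s U V A B = length-cartesianProductWith (λ b a → (U ≐ a) ⟨ s ⟩ (V ≐ b)) B A

  coeffs-⟨⟩ : ∀ s (U V : Vec ℤ N) a b →
              coeffs ((U ≐ a) ⟨ s ⟩ (V ≐ b)) ≡ coeffs ((U ≐ 0ℤ) ⟨ s ⟩ (V ≐ 0ℤ))
  coeffs-⟨⟩ plus U V a b = refl
  coeffs-⟨⟩ minus U V a b = refl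

  resolution : ∀ s {Ax π C D₁ D₂ A B L₁ L₂} → D₁ ∈ π → D₂ ∈ π → D₁ ≈ (L₁ ∷ A) → D₂ ≈ (L₂ ∷ B) →
               C ≈ ((L₁ ⟨ s ⟩ L₂) ∷ (A ++ B)) → Justified Ax π C
  resolution plus = resolution+
  resolution minus = resolution-

module Combination {N : ℕ} (Ax : Line N → Set) (OK : Eqn N → Set) (K Lmax : ℕ) where

  Good : Line N → Set
  Good = Shaped OK K Lmax

  open Extension Ax Good public

  resolve : ∀ s {π L₁ L₂ A B C} → (L₁ ∷ A) ∈≈ π → (L₂ ∷ B) ∈≈ π →
            C ≈ ((L₁ ⟨ s ⟩ L₂) ∷ (A ++ B)) → Good C → Extends 1 π (C ∈≈_)
  resolve s (D₁ , D₁∈ , D₁≈) (D₂ , D₂∈ , D₂≈) C≈ = derive (resolution s D₁∈ D₂∈ D₁≈ D₂≈ C≈)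

  -- V = b is resolved against the literals U = a one at a time, for each b in turn. Every intermediate
  -- line then consists of the remaining U- and V-literals, the sums found so far, R₁ and R₂: it has at most
  -- 4 + k₁ + k₂ sub-disjunctions.
  module _ (s : Sign) (U V : Vec ℤ N) {a₀ : ℤ} {As : List ℤ} {b₀ : ℤ} {Bs : List ℤ} where

    private
      A B : List ℤ
      A = a₀ ∷ As
      B = b₀ ∷ Bs

      sum : ℤ → ℤ → Eqn N
      sum b a = (U ≐ a) ⟨ s ⟩ (V ≐ b)

      split-⊆ : ∀ xs {ys zs : List ℤ} → xs ʳ++ ys ≡ zs → xs ⊆ zs × ys ⊆ zs
      split-⊆ xs {ys} eq = (λ p → ⊆-reflexive-↭ σ (∈-++⁺ˡ p)) , (λ p → ⊆-reflexive-↭ σ (∈-++⁺ʳ xs p))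
        where σ = ↭-trans (↭P.++↭ʳ++ xs ys) (↭-reflexive eq)

      split-length : ∀ xs {ys zs : List ℤ} → xs ʳ++ ys ≡ zs → length xs + length ys ≡ length zs
      split-length xs eq = trans (sym (LP.length-ʳ++ xs)) (cong length eq)

    module _ (R₁ R₂ : Line N) {k₁ k₂ l₁ l₂ : ℕ} (shaped₁ : Shaped OK k₁ l₁ R₁) (shaped₂ : Shaped OK k₂ l₂ R₂)
             (ok-U : ∀ {a} → a ∈ A → OK (U ≐ a)) (ok-V : ∀ {b} → b ∈ B → OK (V ≐ b))
             (ok-sum : ∀ {a b} → a ∈ A → b ∈ B → OK ((U ≐ a) ⟨ s ⟩ (V ≐ b)))
             (few : 4 + (k₁ + k₂) ≤ K) (short : length A + length B + length B * length A + l₁ + l₂ ≤ Lmax)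
             where

      private
        shaped-sums : ∀ {Es} → Es ⊆ pairwise s U V A B → Shaped OK 1 (length Es) Es
        shaped-sums Es⊆ = shaped-block (coeffs (sum 0ℤ 0ℤ)) (All.tabulate ok) (All.tabulate same)
          where
          ok : ∀ {e} → e ∈ _ → OK e
          ok p with b , a , b∈ , a∈ , refl ← ∈-cartesianProductWith⁻ sum B A (Es⊆ p) = ok-sum a∈ b∈
          same : ∀ {e} → e ∈ _ → coeffs e ≡ coeffs (sum 0ℤ 0ℤ)
          same p with b , a , b∈ , a∈ , refl ← ∈-cartesianProductWith⁻ sum B A (Es⊆ p) = coeffs-⟨⟩ s U V a b

      -- Z is the tail of the new lines: it is set-equal to R₁ ++ S, but does not repeat R₁ when S contains it.
      module Row (b : ℤ) (b∈ : b ∈ B) (S Z : Line N) (Z≈ : Z ≈ (R₁ ++ S)) {kZ lZ : ℕ}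
                 (shapedZ : Shaped OK kZ lZ Z) (fewZ : 2 + kZ ≤ K) (shortZ : length A + lZ ≤ Lmax) where

        rowLine : List ℤ → List ℤ → Line N
        rowLine todo done = map (U ≐_) todo ++ (map (sum b) done ++ Z)

        good-rowLine : ∀ todo done → done ʳ++ todo ≡ A → Good (rowLine todo done)
        good-rowLine todo done eq = shaped-mono fewZ lengths
          (shaped-++ (shaped-eqs U todo (λ p → ok-U (todo⊆ p))) (shaped-++ (shaped-sums done-sums) shapedZ))
          where
          done⊆ = proj₁ (split-⊆ done eq)
          todo⊆ = proj₂ (split-⊆ done eq)
          done-sums : map (sum b) done ⊆ pairwise s U V A B
          done-sums p with a , a∈ , refl ← ∈-map⁻ (sum b) p = ∈-cartesianProductWith⁺ sum b∈ (done⊆ a∈)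
          lengths : length todo + (length (map (sum b) done) + lZ) ≤ Lmax
          lengths = ℕP.≤-trans (ℕP.≤-reflexive (begin
            length todo + (length (map (sum b) done) + lZ)
              ≡⟨ cong (λ x → length todo + (x + lZ)) (LP.length-map (sum b) done) ⟩
            length todo + (length done + lZ)               ≡⟨ ℕP.+-assoc (length todo) _ lZ ⟨
            (length todo + length done) + lZ               ≡⟨ cong (_+ lZ) (ℕP.+-comm (length todo) _) ⟩
            (length done + length todo) + lZ               ≡⟨ cong (_+ lZ) (split-length done eq) ⟩
            length A + lZ                                  ∎)) shortZ
            where open ≡-Reasoning

        step : ∀ {π} a todo done {T} → done ʳ++ (a ∷ todo) ≡ A → ((U ≐ a) ∷ T) ∈≈ π → ((V ≐ b) ∷ S) ∈≈ π →
               (T ++ S) ≈ rowLine todo done → Extends 1 π (rowLine todo (a ∷ done) ∈≈_)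
        step a todo done eq P∈ L∈ T≈ = resolve s P∈ L∈ C≈ (good-rowLine todo (a ∷ done) eq)
          where
          C≈ : rowLine todo (a ∷ done) ≈ (sum b a ∷ (_ ++ S))
          C≈ = ≈-trans (↭⇒≈ (↭P.shift (sum b a) (map (U ≐_) todo) (map (sum b) done ++ Z)))
                       (++⁺ˡ-≈ (sum b a ∷ []) (≈-sym T≈))

        sweep : ∀ {π} a todo done {T} → done ʳ++ (a ∷ todo) ≡ A → ((U ≐ a) ∷ T) ∈≈ π → ((V ≐ b) ∷ S) ∈≈ π →
                (T ++ S) ≈ rowLine todo done →
                Extends (suc (length todo)) π ((map (sum b) (todo ʳ++ (a ∷ done)) ++ Z) ∈≈_)
        sweep a []           done eq P∈ L∈ T≈ = step a [] done eq P∈ L∈ T≈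
        sweep a (a′ ∷ todo) done eq P∈ L∈ T≈ =
          bind (step a (a′ ∷ todo) done eq P∈ L∈ T≈) λ π⊆ C∈ →
          sweep a′ todo (a ∷ done) eq C∈ (∈≈-mono π⊆ L∈) (++-absorbʳ S⊆)
          where
          S⊆ : S ⊆ rowLine todo (a ∷ done)
          S⊆ p = ∈-++⁺ʳ (map (U ≐_) todo) (∈-++⁺ʳ (map (sum b) (a ∷ done)) (proj₂ Z≈ (∈-++⁺ʳ R₁ p)))

        row : ∀ {π} → (map (U ≐_) A ++ R₁) ∈≈ π → ((V ≐ b) ∷ S) ∈≈ π →
              Extends (length A) π ((map (sum b) (reverse A) ++ Z) ∈≈_)
        row D∈ L∈ = sweep a₀ As [] refl D∈ L∈
          (≈-trans (≡⇒≈ (LP.++-assoc (map (U ≐_) As) R₁ S)) (++⁺ˡ-≈ (map (U ≐_) As) (≈-sym Z≈)))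

      private
        rows : List ℤ → Line N
        rows done = cartesianProductWith sum done (reverse A)

        rows-⊆ : ∀ {done} → done ⊆ B → rows done ⊆ pairwise s U V A B
        rows-⊆ done⊆ = cartesianProductWith-⊆ sum done⊆ (⊆-reflexive-↭ (↭P.↭-reverse A))

        length-rows : ∀ done → length (rows done) ≡ length done * length A
        length-rows done = trans (length-cartesianProductWith sum done (reverse A))
                                 (cong (length done *_) (LP.length-reverse A))

        outerLine : List ℤ → List ℤ → Line N → Line N
        outerLine todo done Y = map (V ≐_) todo ++ (R₂ ++ (rows done ++ Y))

        outerLine-assoc : ∀ todo done Y → outerLine todo done Y ≡ (map (V ≐_) todo ++ (R₂ ++ rows done)) ++ Y
        outerLine-assoc todo done Y =
          trans (cong (map (V ≐_) todo ++_) (sym (LP.++-assoc R₂ (rows done) Y)))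
                (sym (LP.++-assoc (map (V ≐_) todo) _ Y))

        outerLine-absorb : ∀ todo done {Y} → Y ⊆ R₁ → outerLine todo done R₁ ≈ (R₁ ++ outerLine todo done Y)
        outerLine-absorb todo done {Y} Y⊆ =
          ≈-trans (≡⇒≈ (outerLine-assoc todo done R₁))
                  (≈-trans (absorb-swap Y⊆) (++⁺ˡ-≈ R₁ (≡⇒≈ (sym (outerLine-assoc todo done Y)))))

        row-inside : ∀ b todo done →
                     (map (sum b) (reverse A) ++ outerLine todo done R₁) ↭ outerLine todo (b ∷ done) R₁
        row-inside b todo done =
          ↭-trans (↭P.shifts new (map (V ≐_) todo))
                  (↭P.++⁺ˡ (map (V ≐_) todo) (↭-trans (↭P.shifts new R₂)
                    (↭P.++⁺ˡ R₂ (↭-reflexive (sym (LP.++-assoc new (rows done) R₁))))))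
          where new = map (sum b) (reverse A)

        shaped-outer : ∀ {todo done} → todo ⊆ B → done ⊆ B →
                       Shaped OK (1 + (k₂ + (1 + k₁))) (length todo + (l₂ + (length done * length A + l₁)))
                              (outerLine todo done R₁)
        shaped-outer {todo} {done} todo⊆ done⊆ =
          shaped-++ (shaped-eqs V todo (λ p → ok-V (todo⊆ p)))
            (shaped-++ shaped₂
              (shaped-++ (shaped-mono ℕP.≤-refl (ℕP.≤-reflexive (length-rows done)) (shaped-sums (rows-⊆ done⊆)))
                         shaped₁))

        few-outer : 2 + (1 + (k₂ + (1 + k₁))) ≤ K
        few-outer = ℕP.≤-trans (ℕP.≤-reflexive (cong (3 +_) (trans (ℕP.+-suc k₂ k₁) (cong suc (ℕP.+-comm k₂ k₁)))))
                               few

        short-outer : ∀ (todo done : List ℤ) → length todo ≤ length B → length done ≤ length B →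
                      length A + (length todo + (l₂ + (length done * length A + l₁))) ≤ Lmax
        short-outer todo done todo≤ done≤ = ℕP.≤-trans
          (ℕP.+-monoʳ-≤ (length A)
            (ℕP.+-mono-≤ todo≤ (ℕP.+-monoʳ-≤ l₂ (ℕP.+-monoˡ-≤ l₁ (ℕP.*-monoˡ-≤ (length A) done≤)))))
          (ℕP.≤-trans (ℕP.≤-reflexive (rearrange (length A) (length B) (length B * length A) l₁ l₂)) short)
          where
          rearrange : ∀ a b c l₁ l₂ → a + (b + (l₂ + (c + l₁))) ≡ a + b + c + l₁ + l₂
          rearrange = solve-∀

        next-row : ∀ {π} b todo done {Y} → done ʳ++ (b ∷ todo) ≡ B → Y ⊆ R₁ → (map (U ≐_) A ++ R₁) ∈≈ π →
                   outerLine (b ∷ todo) done Y ∈≈ π → Extends (length A) π (outerLine todo (b ∷ done) R₁ ∈≈_)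
        next-row b todo done {Y} eq Y⊆ D∈ O∈ =
          fmap (∈≈-resp-≈ (↭⇒≈ (row-inside b todo done)))
            (Row.row b (b∷todo⊆ (here refl)) (outerLine todo done Y) (outerLine todo done R₁)
                     (outerLine-absorb todo done Y⊆) (shaped-outer todo⊆ done⊆) few-outer
                     (short-outer todo done todo≤ done≤) D∈ O∈)
          where
          done⊆ = proj₁ (split-⊆ done eq)
          b∷todo⊆ = proj₂ (split-⊆ done eq)
          todo⊆ : todo ⊆ B
          todo⊆ p = b∷todo⊆ (there p)
          todo≤ : length todo ≤ length B
          todo≤ = ℕP.≤-trans (ℕP.n≤1+n _)
                    (ℕP.≤-trans (ℕP.m≤n+m _ (length done)) (ℕP.≤-reflexive (split-length done eq)))
          done≤ : length done ≤ length B
          done≤ = ℕP.≤-trans (ℕP.m≤m+n _ _) (ℕP.≤-reflexive (split-length done eq))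

        all-rows : ∀ {π} b todo done {Y} → done ʳ++ (b ∷ todo) ≡ B → Y ⊆ R₁ → (map (U ≐_) A ++ R₁) ∈≈ π →
                   outerLine (b ∷ todo) done Y ∈≈ π →
                   Extends (suc (length todo) * length A) π (outerLine [] (todo ʳ++ (b ∷ done)) R₁ ∈≈_)
        all-rows b [] done eq Y⊆ D∈ O∈ =
          relax (ℕP.≤-reflexive (sym (ℕP.*-identityˡ (length A)))) (next-row b [] done eq Y⊆ D∈ O∈)
        all-rows b (b′ ∷ todo) done eq Y⊆ D∈ O∈ =
          bind (next-row b (b′ ∷ todo) done eq Y⊆ D∈ O∈) λ π⊆ O′∈ →
          all-rows b′ todo (b ∷ done) eq ⊆-refl (∈≈-mono π⊆ D∈) O′∈

        rows-reverse : rows (reverse B) ≈ pairwise s U V A B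
        rows-reverse = rows-⊆ (⊆-reflexive-↭ (↭P.↭-reverse B))
                     , cartesianProductWith-⊆ sum (⊆-reflexive-↭ (↭-sym (↭P.↭-reverse B)))
                                                  (⊆-reflexive-↭ (↭-sym (↭P.↭-reverse A)))

      resolve-pairwise : ∀ {π} → (map (U ≐_) A ++ R₁) ∈≈ π → (map (V ≐_) B ++ R₂) ∈≈ π →
                         Extends (length B * length A) π ((pairwise s U V A B ++ (R₁ ++ R₂)) ∈≈_)
      resolve-pairwise D₁∈ D₂∈ =
        fmap (∈≈-resp-≈ result≈)
             (all-rows b₀ Bs [] refl (λ ()) D₁∈
                       (∈≈-resp-≈ (≡⇒≈ (cong (map (V ≐_) B ++_) (sym (LP.++-identityʳ R₂)))) D₂∈))
        where
        result≈ : (R₂ ++ (rows (reverse B) ++ R₁)) ≈ (pairwise s U V A B ++ (R₁ ++ R₂))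
        result≈ = ≈-trans (↭⇒≈ (↭-trans (↭P.shifts R₂ (rows (reverse B)))
                                         (↭P.++⁺ˡ (rows (reverse B)) (↭P.++-comm R₂ R₁))))
                          (++⁺ʳ-≈ (R₁ ++ R₂) rows-reverse)

-- Indicator vectors of rectangles in the grid of variables

∥_∥₁ : Vec ℤ N → ℕ
∥ v ∥₁ = V.sum (V.map ∣_∣ v)

vec-ext : {u v : Vec ℤ N} → (∀ z → lookup u z ≡ lookup v z) → u ≡ v
vec-ext {u = u} {v} eq =
  trans (sym (VP.tabulate∘lookup u)) (trans (VP.tabulate-cong eq) (VP.tabulate∘lookup v))

∥∥₁-triangle : (u v : Vec ℤ N) → ∥ zipWith ℤ._+_ u v ∥₁ ≤ ∥ u ∥₁ + ∥ v ∥₁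
∥∥₁-triangle []       []       = z≤n
∥∥₁-triangle (x ∷ u) (y ∷ v) = ℕP.≤-trans
  (ℕP.+-mono-≤ (ℤP.∣i+j∣≤∣i∣+∣j∣ x y) (∥∥₁-triangle u v))
  (ℕP.≤-reflexive (+-interchange ∣ x ∣ ∣ y ∣ ∥ u ∥₁ ∥ v ∥₁))

∥∥₁-mono : (u v : Vec ℤ N) → (∀ z → ∣ lookup u z ∣ ≤ ∣ lookup v z ∣) → ∥ u ∥₁ ≤ ∥ v ∥₁
∥∥₁-mono []      []      le = z≤n
∥∥₁-mono (x ∷ u) (y ∷ v) le = ℕP.+-mono-≤ (le F.zero) (∥∥₁-mono u v (λ z → le (F.suc z)))

∥∥₁-zero : (v : Vec ℤ N) → (∀ z → lookup v z ≡ 0ℤ) → ∥ v ∥₁ ≡ 0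
∥∥₁-zero []      all0 = refl
∥∥₁-zero (x ∷ v) all0 rewrite all0 F.zero = ∥∥₁-zero v (λ z → all0 (F.suc z))

∥zeroVec∥₁ : ∀ N → ∥ zeroVec {N} ∥₁ ≡ 0
∥zeroVec∥₁ zero    = refl
∥zeroVec∥₁ (suc N) = ∥zeroVec∥₁ N

∥unit∥₁ : (h : Fin N) → ∥ unit h ∥₁ ≡ 1
∥unit∥₁ {suc N} F.zero    = cong suc (∥zeroVec∥₁ N)
∥unit∥₁ {suc N} (F.suc h) = ∥unit∥₁ h

zipWith-inverseʳ : (v : Vec ℤ N) → zipWith ℤ._-_ v v ≡ zeroVec
zipWith-inverseʳ v = vec-ext λ z → begin
  lookup (zipWith ℤ._-_ v v) z  ≡⟨ VP.lookup-zipWith ℤ._-_ z v v ⟩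
  lookup v z ℤ.- lookup v z      ≡⟨ ℤP.+-inverseʳ (lookup v z) ⟩
  0ℤ                             ≡⟨ VP.lookup-replicate z 0ℤ ⟨
  lookup zeroVec z               ∎
  where open ≡-Reasoning

χ : ℕ → ℕ → ℕ → ℤ
χ a b x = if does (a ≤? x) ∧ does (x <? b) then 1ℤ else 0ℤ

module _ {a b x : ℕ} where

  χ-inside : a ≤ x → x < b → χ a b x ≡ 1ℤ
  χ-inside a≤x x<b rewrite dec-true (a ≤? x) a≤x | dec-true (x <? b) x<b = refl

  χ-below : x < a → χ a b x ≡ 0ℤ
  χ-below x<a rewrite dec-false (a ≤? x) (ℕP.<⇒≱ x<a) = refl

  χ-above : b ≤ x → χ a b x ≡ 0ℤ
  χ-above b≤x rewrite dec-false (x <? b) (ℕP.≤⇒≯ b≤x) with does (a ≤? x)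
  ... | true  = refl
  ... | false = refl

  ∣χ∣≤1 : ∣ χ a b x ∣ ≤ 1
  ∣χ∣≤1 with does (a ≤? x) ∧ does (x <? b)
  ... | true  = ℕP.≤-refl
  ... | false = z≤n

∣χ∣≤∣χ₀∣ : ∀ {a b x} → ∣ χ a b x ∣ ≤ ∣ χ 0 b x ∣
∣χ∣≤∣χ₀∣ {a} {b} {x} with x <? b
... | yes x<b rewrite χ-inside {0} {b} {x} z≤n x<b = ∣χ∣≤1 {a} {b} {x}
... | no  x≮b rewrite χ-above {a} {b} {x} (ℕP.≮⇒≥ x≮b) = z≤n

χ-split : ∀ {a b c} → a ≤ b → b ≤ c → ∀ x → χ a b x ℤ.+ χ b c x ≡ χ a c x
χ-split {a} {b} {c} a≤b b≤c x with x <? a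
... | yes x<a
  rewrite χ-below {a} {b} x<a | χ-below {b} {c} (ℕP.<-≤-trans x<a a≤b) | χ-below {a} {c} x<a = refl
... | no x≮a with x <? b
...   | yes x<b
  rewrite χ-inside {a} {b} (ℕP.≮⇒≥ x≮a) x<b | χ-below {b} {c} x<b
        | χ-inside {a} {c} (ℕP.≮⇒≥ x≮a) (ℕP.<-≤-trans x<b b≤c) = refl
...   | no x≮b with x <? c
...     | yes x<c
  rewrite χ-above {a} {b} (ℕP.≮⇒≥ x≮b) | χ-inside {b} {c} (ℕP.≮⇒≥ x≮b) x<c
        | χ-inside {a} {c} (ℕP.≮⇒≥ x≮a) x<c = refl
...     | no x≮c
  rewrite χ-above {a} {b} (ℕP.≮⇒≥ x≮b) | χ-above {b} {c} (ℕP.≮⇒≥ x≮c) | χ-above {a} {c} (ℕP.≮⇒≥ x≮c) = refl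

χ-empty : ∀ a x → χ a a x ≡ 0ℤ
χ-empty a x with x <? a
... | yes x<a = χ-below {a} {a} x<a
... | no  x≮a = χ-above {a} {a} (ℕP.≮⇒≥ x≮a)

χ-off-point : ∀ {i x} → x ≢ i → χ i (suc i) x ≡ 0ℤ
χ-off-point {i} {x} x≢i with ℕP.<-cmp x i
... | tri< x<i _ _ = χ-below {i} {suc i} x<i
... | tri≈ _ x≡i _ = contradiction x≡i x≢i
... | tri> _ _ i<x = χ-above {i} {suc i} i<x

module Grid (m n : ℕ) where

  row col : Fin (m * n) → ℕ
  row z = toℕ (proj₁ (remQuot {m} n z))
  col z = toℕ (proj₂ (remQuot {m} n z))

  box : ℕ → ℕ → ℕ → ℕ → Vec ℤ (m * n)
  box a b c d = tabulate λ z → χ a b (row z) ℤ.* χ c d (col z)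

  lookup-box : ∀ a b c d z → lookup (box a b c d) z ≡ χ a b (row z) ℤ.* χ c d (col z)
  lookup-box a b c d = VP.lookup∘tabulate _

  ∣lookup-box∣≤1 : ∀ a b c d z → ∣ lookup (box a b c d) z ∣ ≤ 1
  ∣lookup-box∣≤1 a b c d z rewrite lookup-box a b c d z | ℤP.abs-* (χ a b (row z)) (χ c d (col z)) =
    ℕP.*-mono-≤ (∣χ∣≤1 {a} {b}) (∣χ∣≤1 {c} {d})

  box-split-rows : ∀ {a b c} → a ≤ b → b ≤ c → ∀ d e →
                   zipWith ℤ._+_ (box a b d e) (box b c d e) ≡ box a c d e
  box-split-rows {a} {b} {c} a≤b b≤c d e = vec-ext λ z → begin
    lookup (zipWith ℤ._+_ (box a b d e) (box b c d e)) z
      ≡⟨ VP.lookup-zipWith ℤ._+_ z (box a b d e) (box b c d e) ⟩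
    lookup (box a b d e) z ℤ.+ lookup (box b c d e) z
      ≡⟨ cong₂ ℤ._+_ (lookup-box a b d e z) (lookup-box b c d e z) ⟩
    χ a b (row z) ℤ.* χ d e (col z) ℤ.+ χ b c (row z) ℤ.* χ d e (col z)
      ≡⟨ ℤP.*-distribʳ-+ (χ d e (col z)) (χ a b (row z)) _ ⟨
    (χ a b (row z) ℤ.+ χ b c (row z)) ℤ.* χ d e (col z)
      ≡⟨ cong (ℤ._* χ d e (col z)) (χ-split a≤b b≤c (row z)) ⟩
    χ a c (row z) ℤ.* χ d e (col z)
      ≡⟨ lookup-box a c d e z ⟨
    lookup (box a c d e) z ∎
    where open ≡-Reasoning

  box-split-cols : ∀ {a b c} → a ≤ b → b ≤ c → ∀ d e →
                   zipWith ℤ._+_ (box d e a b) (box d e b c) ≡ box d e a c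
  box-split-cols {a} {b} {c} a≤b b≤c d e = vec-ext λ z → begin
    lookup (zipWith ℤ._+_ (box d e a b) (box d e b c)) z
      ≡⟨ VP.lookup-zipWith ℤ._+_ z (box d e a b) (box d e b c) ⟩
    lookup (box d e a b) z ℤ.+ lookup (box d e b c) z
      ≡⟨ cong₂ ℤ._+_ (lookup-box d e a b z) (lookup-box d e b c z) ⟩
    χ d e (row z) ℤ.* χ a b (col z) ℤ.+ χ d e (row z) ℤ.* χ b c (col z)
      ≡⟨ ℤP.*-distribˡ-+ (χ d e (row z)) (χ a b (col z)) _ ⟨
    χ d e (row z) ℤ.* (χ a b (col z) ℤ.+ χ b c (col z))
      ≡⟨ cong (χ d e (row z) ℤ.*_) (χ-split a≤b b≤c (col z)) ⟩
    χ d e (row z) ℤ.* χ a c (col z)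
      ≡⟨ lookup-box d e a c z ⟨
    lookup (box d e a c) z ∎
    where open ≡-Reasoning

  var≡box : (i : Fin m) (k : Fin n) → var i k ≡ box (toℕ i) (suc (toℕ i)) (toℕ k) (suc (toℕ k))
  var≡box i k = vec-ext λ z → trans (entry z) (sym (lookup-box (toℕ i) (suc (toℕ i)) (toℕ k) (suc (toℕ k)) z))
    where
    entry : ∀ z → lookup (var i k) z ≡ χ (toℕ i) (suc (toℕ i)) (row z) ℤ.* χ (toℕ k) (suc (toℕ k)) (col z)
    entry z with z F.≟ combine i k
    ... | yes refl = begin
      lookup (var i k) (combine i k)  ≡⟨ VP.lookup∘update (combine i k) zeroVec 1ℤ ⟩
      1ℤ ℤ.* 1ℤ                       ≡⟨ cong₂ ℤ._*_ (on-diagonal i (cong proj₁ ik)) (on-diagonal k (cong proj₂ ik)) ⟨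
      χ (toℕ i) (suc (toℕ i)) (row (combine i k)) ℤ.* χ (toℕ k) (suc (toℕ k)) (col (combine i k)) ∎
      where
      open ≡-Reasoning
      ik = FP.remQuot-combine i k
      on-diagonal : ∀ {l} (j : Fin l) {j′} → j′ ≡ j → χ (toℕ j) (suc (toℕ j)) (toℕ j′) ≡ 1ℤ
      on-diagonal j refl = χ-inside {toℕ j} {suc (toℕ j)} ℕP.≤-refl ℕP.≤-refl
    ... | no z≢ik rewrite VP.lookup∘update′ z≢ik zeroVec 1ℤ | VP.lookup-replicate z 0ℤ
      with row z ℕ.≟ toℕ i | col z ℕ.≟ toℕ k
    ...   | no r≢i | _       rewrite χ-off-point r≢i = refl
    ...   | yes _  | no c≢k  rewrite χ-off-point c≢k = sym (ℤP.*-zeroʳ (χ (toℕ i) (suc (toℕ i)) (row z)))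
    ...   | yes r≡i | yes c≡k = contradiction
      (trans (sym (FP.combine-remQuot {m} n z)) (cong₂ combine (FP.toℕ-injective r≡i) (FP.toℕ-injective c≡k)))
      z≢ik

  ∥empty-rows∥₁ : ∀ a c d → ∥ box a a c d ∥₁ ≡ 0
  ∥empty-rows∥₁ a c d = ∥∥₁-zero (box a a c d) λ z →
    trans (lookup-box a a c d z) (trans (cong (ℤ._* χ c d (col z)) (χ-empty a (row z))) (ℤP.*-zeroˡ (χ c d (col z))))

  ∥empty-cols∥₁ : ∀ a b c → ∥ box a b c c ∥₁ ≡ 0
  ∥empty-cols∥₁ a b c = ∥∥₁-zero (box a b c c) λ z →
    trans (lookup-box a b c c z) (trans (cong (χ a b (row z) ℤ.*_) (χ-empty c (col z))) (ℤP.*-zeroʳ (χ a b (row z))))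

  ∥row-prefix∥₁ : ∀ r c → r < m → c ≤ n → ∥ box r (suc r) 0 c ∥₁ ≤ c
  ∥row-prefix∥₁ r zero    r<m c≤n = ℕP.≤-reflexive (∥empty-cols∥₁ r (suc r) 0)
  ∥row-prefix∥₁ r (suc c) r<m c<n = begin
    ∥ box r (suc r) 0 (suc c) ∥₁
      ≡⟨ cong ∥_∥₁ (box-split-cols z≤n (ℕP.n≤1+n c) r (suc r)) ⟨
    ∥ zipWith ℤ._+_ (box r (suc r) 0 c) (box r (suc r) c (suc c)) ∥₁
      ≤⟨ ∥∥₁-triangle (box r (suc r) 0 c) _ ⟩
    ∥ box r (suc r) 0 c ∥₁ + ∥ box r (suc r) c (suc c) ∥₁
      ≤⟨ ℕP.+-mono-≤ (∥row-prefix∥₁ r c r<m (ℕP.<⇒≤ c<n)) (ℕP.≤-reflexive ∥cell∥₁) ⟩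
    c + 1
      ≡⟨ ℕP.+-comm c 1 ⟩
    suc c ∎
    where
    open ℕP.≤-Reasoning
    ∥cell∥₁ : ∥ box r (suc r) c (suc c) ∥₁ ≡ 1
    ∥cell∥₁ = begin-equality
      ∥ box r (suc r) c (suc c) ∥₁
        ≡⟨ cong₂ (λ i k → ∥ box i (suc i) k (suc k) ∥₁) (FP.toℕ-fromℕ< r<m) (FP.toℕ-fromℕ< c<n) ⟨
      ∥ box (toℕ ι) (suc (toℕ ι)) (toℕ κ) (suc (toℕ κ)) ∥₁  ≡⟨ cong ∥_∥₁ (var≡box ι κ) ⟨
      ∥ var ι κ ∥₁                                          ≡⟨ ∥unit∥₁ (combine ι κ) ⟩
      1                                                     ∎
      where
      ι = fromℕ< r<m
      κ = fromℕ< c<n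

  ∥top-rows∥₁ : ∀ r → r ≤ m → ∥ box 0 r 0 n ∥₁ ≤ r * n
  ∥top-rows∥₁ zero    r≤m = ℕP.≤-reflexive (∥empty-rows∥₁ 0 0 n)
  ∥top-rows∥₁ (suc r) r<m = begin
    ∥ box 0 (suc r) 0 n ∥₁                               ≡⟨ cong ∥_∥₁ (box-split-rows z≤n (ℕP.n≤1+n r) 0 n) ⟨
    ∥ zipWith ℤ._+_ (box 0 r 0 n) (box r (suc r) 0 n) ∥₁ ≤⟨ ∥∥₁-triangle (box 0 r 0 n) _ ⟩
    ∥ box 0 r 0 n ∥₁ + ∥ box r (suc r) 0 n ∥₁
      ≤⟨ ℕP.+-mono-≤ (∥top-rows∥₁ r (ℕP.<⇒≤ r<m)) (∥row-prefix∥₁ r n r<m ℕP.≤-refl) ⟩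
    r * n + n                                            ≡⟨ ℕP.+-comm (r * n) n ⟩
    suc r * n                                            ∎
    where open ℕP.≤-Reasoning

  ∥box∥₁≤ : ∀ a b c d → b ≤ m → ∥ box a b c d ∥₁ ≤ b * n
  ∥box∥₁≤ a b c d b≤m = ℕP.≤-trans (∥∥₁-mono (box a b c d) (box 0 b 0 n) inside) (∥top-rows∥₁ b b≤m)
    where
    inside : ∀ z → ∣ lookup (box a b c d) z ∣ ≤ ∣ lookup (box 0 b 0 n) z ∣
    inside z rewrite lookup-box a b c d z | lookup-box 0 b 0 n z
                   | ℤP.abs-* (χ a b (row z)) (χ c d (col z)) | ℤP.abs-* (χ 0 b (row z)) (χ 0 n (col z))
                   | χ-inside {0} {n} {col z} z≤n (FP.toℕ<n (proj₂ (remQuot {m} n z))) =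
      ℕP.*-mono-≤ (∣χ∣≤∣χ₀∣ {a} {b} {row z}) (∣χ∣≤1 {c} {d} {col z})

interval : ℕ → ℕ → List ℤ
interval lo l = applyUpTo (λ i → ℤ.+ (lo + i)) (suc l)

module _ {lo l : ℕ} where

  ∈-interval⁺ : ∀ {i} → i ≤ l → ℤ.+ (lo + i) ∈ interval lo l
  ∈-interval⁺ i≤l = ∈-applyUpTo⁺ (λ i → ℤ.+ (lo + i)) (s≤s i≤l)

  ∈-interval⁻ : ∀ {y} → y ∈ interval lo l → ∃[ i ] (i ≤ l × y ≡ ℤ.+ (lo + i))
  ∈-interval⁻ y∈ with i , s≤s i≤l , refl ← ∈-applyUpTo⁻ (λ i → ℤ.+ (lo + i)) y∈ = i , i≤l , refl

  length-interval : length (interval lo l) ≡ suc l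
  length-interval = LP.length-applyUpTo (λ i → ℤ.+ (lo + i)) (suc l)

split-≤-+ : ∀ {i} l₁ l₂ → i ≤ l₁ + l₂ → ∃[ i₁ ] ∃[ i₂ ] (i₁ ≤ l₁ × i₂ ≤ l₂ × i₁ + i₂ ≡ i)
split-≤-+ {i} l₁ l₂ i≤ with i ≤? l₁
... | yes i≤l₁ = i , 0 , i≤l₁ , z≤n , ℕP.+-identityʳ i
... | no  i≰l₁ = l₁ , i ∸ l₁ , ℕP.≤-refl , ℕP.m≤n+o⇒m∸n≤o i l₁ i≤ , ℕP.m+[n∸m]≡n (ℕP.≰⇒≥ i≰l₁)

separated-intervals : ∀ {n l a b} → a ∈ interval 0 n → b ∈ interval (suc n) l → a ℤ.- b ≢ 0ℤ
separated-intervals {n} {l} a∈ b∈ a-b≡0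
  with i , i≤n , refl ← ∈-interval⁻ {0} {n} a∈ | j , _ , refl ← ∈-interval⁻ {suc n} {l} b∈ =
  ℕP.≤⇒≯ i≤n (ℕP.<-≤-trans (ℕP.n<1+n n) (ℕP.≤-trans (ℕP.m≤m+n (suc n) j)
    (ℕP.≤-reflexive (sym (ℤP.+-injective (ℤP.i-j≡0⇒i≡j (ℤ.+ i) (ℤ.+ (suc n + j)) a-b≡0))))))

infix 6 _≐∈_
_≐∈_ : Vec ℤ N → List ℤ → Line N
v ≐∈ I = map (v ≐_) I

sum-intervals : ∀ {U V W : Vec ℤ N} {lo₁ l₁ lo₂ l₂ lo l} →
                zipWith ℤ._+_ U V ≡ W → lo₁ + lo₂ ≡ lo → l₁ + l₂ ≡ l →
                pairwise plus U V (interval lo₁ l₁) (interval lo₂ l₂) ≈ (W ≐∈ interval lo l)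
sum-intervals {U = U} {V} {W} {lo₁} {l₁} {lo₂} {l₂} refl refl refl = to , from
  where
  add : ℤ → ℤ → Eqn _
  add b a = (U ≐ a) ⊕ (V ≐ b)
  to : _ ⊆ _
  to e∈ with b , a , b∈ , a∈ , refl ← ∈-cartesianProductWith⁻ add (interval lo₂ l₂) (interval lo₁ l₁) e∈
    with j , j≤ , refl ← ∈-interval⁻ b∈ | i , i≤ , refl ← ∈-interval⁻ a∈ =
    subst (λ x → (W ≐ ℤ.+ x) ∈ W ≐∈ interval (lo₁ + lo₂) (l₁ + l₂)) (sym (+-interchange lo₁ i lo₂ j))
          (∈-map⁺ (W ≐_) (∈-interval⁺ {lo₁ + lo₂} {l₁ + l₂} (ℕP.+-mono-≤ i≤ j≤)))
  from : _ ⊆ _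
  from e∈ with f , f∈ , refl ← ∈-map⁻ (W ≐_) e∈
    with t , t≤ , refl ← ∈-interval⁻ {lo₁ + lo₂} {l₁ + l₂} f∈
    with i , j , i≤ , j≤ , refl ← split-≤-+ l₁ l₂ t≤ =
    subst (λ x → (W ≐ ℤ.+ x) ∈ cartesianProductWith add (interval lo₂ l₂) (interval lo₁ l₁))
          (+-interchange lo₁ i lo₂ j)
          (∈-cartesianProductWith⁺ add (∈-interval⁺ {lo₂} {l₂} j≤) (∈-interval⁺ {lo₁} {l₁} i≤))

PolyBounded : (ℕ → ℕ) → Set
PolyBounded f = ∃[ c ] ∃[ d ] (∀ x → f x ≤ c * suc x ^ d)

private
  ^-mono : ∀ x d e → suc x ^ d ≤ suc x ^ (d + e)
  ^-mono x d e = ℕP.^-monoʳ-≤ (suc x) (ℕP.m≤m+n d e)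

poly-const : ∀ k → PolyBounded (λ _ → k)
poly-const k = k , 0 , λ x → ℕP.≤-reflexive (sym (ℕP.*-identityʳ k))

poly-id : PolyBounded (λ x → x)
poly-id = 1 , 1 , λ x →
  ℕP.≤-trans (ℕP.n≤1+n x) (ℕP.≤-reflexive (sym (trans (ℕP.*-identityˡ _) (ℕP.*-identityʳ (suc x)))))

poly-+ : ∀ {f g} → PolyBounded f → PolyBounded g → PolyBounded (λ x → f x + g x)
poly-+ {f} {g} (c₁ , d₁ , f≤) (c₂ , d₂ , g≤) = c₁ + c₂ , d₁ + d₂ , λ x → begin
  f x + g x                                            ≤⟨ ℕP.+-mono-≤ (f≤ x) (g≤ x) ⟩
  c₁ * suc x ^ d₁ + c₂ * suc x ^ d₂                 ≤⟨ ℕP.+-mono-≤ (ℕP.*-monoʳ-≤ c₁ (^-mono x d₁ d₂))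
                                                                   (ℕP.*-monoʳ-≤ c₂ (^-mono′ x d₂ d₁)) ⟩
  c₁ * suc x ^ (d₁ + d₂) + c₂ * suc x ^ (d₁ + d₂)   ≡⟨ ℕP.*-distribʳ-+ (suc x ^ (d₁ + d₂)) c₁ c₂ ⟨
  (c₁ + c₂) * suc x ^ (d₁ + d₂)                     ∎
  where
  open ℕP.≤-Reasoning
  ^-mono′ : ∀ x d e → suc x ^ d ≤ suc x ^ (e + d)
  ^-mono′ x d e = ℕP.^-monoʳ-≤ (suc x) (ℕP.m≤n+m d e)

poly-* : ∀ {f g} → PolyBounded f → PolyBounded g → PolyBounded (λ x → f x * g x)
poly-* {f} {g} (c₁ , d₁ , f≤) (c₂ , d₂ , g≤) = c₁ * c₂ , d₁ + d₂ , λ x → begin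
  f x * g x                                        ≤⟨ ℕP.*-mono-≤ (f≤ x) (g≤ x) ⟩
  (c₁ * suc x ^ d₁) * (c₂ * suc x ^ d₂)         ≡⟨ *-interchange c₁ (suc x ^ d₁) c₂ (suc x ^ d₂) ⟩
  (c₁ * c₂) * (suc x ^ d₁ * suc x ^ d₂)         ≡⟨ cong ((c₁ * c₂) *_) (ℕP.^-distribˡ-+-* (suc x) d₁ d₂) ⟨
  (c₁ * c₂) * suc x ^ (d₁ + d₂)                 ∎
  where open ℕP.≤-Reasoning

-- The refutation of ¬PHP^m_n

freeBound lengthBound eqnBound lineBound combineCost columnStep columnCost rowStep rowCost refutationLength
  refutationSize : ℕ → ℕ
freeBound n   = suc n * suc n
eqnBound n    = suc n * n + freeBound n
lengthBound n = suc (freeBound n)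
lineBound n   = lengthBound n + lengthBound n + lengthBound n * lengthBound n + lengthBound n + lengthBound n
combineCost n = lengthBound n * lengthBound n
columnStep n  = n * (1 + combineCost n) + (1 + (combineCost n + combineCost n))
columnCost n  = suc n * columnStep n
rowStep n     = 1 + (combineCost n + (combineCost n + combineCost n))
rowCost n     = 2 + n * rowStep n
refutationLength n =
  n * (columnCost n + combineCost n) + (suc n * (rowCost n + combineCost n) + (combineCost n + combineCost n))
refutationSize n = refutationLength n * (lineBound n * eqnBound n)

lineSize≤ : ∀ S (X : Line N) → All (λ e → eqnSize e ≤ S) X → lineSize X ≤ length X * S
lineSize≤ S []      []         = z≤n
lineSize≤ S (e ∷ X) (e≤ ∷ X≤) = ℕP.+-mono-≤ e≤ (lineSize≤ S X X≤)

proofSize≤ : ∀ S (π : List (Line N)) → All (λ X → lineSize X ≤ S) π → proofSize π ≤ length π * S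
proofSize≤ S []      []         = z≤n
proofSize≤ S (X ∷ π) (X≤ ∷ π≤) = ℕP.+-mono-≤ X≤ (proofSize≤ S π π≤)

module Pigeonhole (m n′ : ℕ) (n<m : suc n′ < m) where

  n : ℕ
  n = suc n′

  open Grid m n

  M E L Lmax C : ℕ
  M = freeBound n
  E = eqnBound n
  L = lengthBound n
  Lmax = lineBound n
  C = combineCost n

  ≤suc-n⇒≤M : ∀ {a} → a ≤ suc n → a ≤ M
  ≤suc-n⇒≤M a≤ = ℕP.≤-trans a≤ (ℕP.m≤m*n (suc n) (suc n))

  ≤M⇒≤L : ∀ {a} → a ≤ M → a ≤ L
  ≤M⇒≤L a≤ = ℕP.≤-trans a≤ (ℕP.n≤1+n M)

  Small : Vec ℤ (m * n) → Set
  Small v = (∀ z → ∣ lookup v z ∣ ≤ 1) × ∥ v ∥₁ ≤ suc n * n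

  small-box : ∀ a b c d → b ≤ suc n → Small (box a b c d)
  small-box a b c d b≤ =
    ∣lookup-box∣≤1 a b c d , ℕP.≤-trans (∥box∥₁≤ a b c d (ℕP.≤-trans b≤ n<m)) (ℕP.*-monoˡ-≤ n b≤)

  record Bounded (e : Eqn (m * n)) : Set where
    constructor bounded
    field
      unit-coeffs : ∀ z → ∣ lookup (coeffs e) z ∣ ≤ 1
      small : eqnSize e ≤ E

  bounded-eqn : ∀ {v f} → Small v → ∣ f ∣ ≤ M → Bounded (v ≐ f)
  bounded-eqn (unit , norm) f≤ = bounded unit (ℕP.+-mono-≤ norm f≤)

  open Combination (PHP m n) Bounded 8 Lmax public

  Tail : Line (m * n) → Set
  Tail = Shaped Bounded 2 L

  good : ∀ {k l X} → Shaped Bounded k l X → k ≤ 8 → l ≤ L → Good X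
  good shaped k≤ l≤ = shaped-mono k≤ (ℕP.≤-trans l≤ L≤Lmax) shaped
    where
    L≤Lmax : L ≤ Lmax
    L≤Lmax = ℕP.≤-trans (ℕP.m≤m+n L L) (ℕP.≤-trans (ℕP.m≤m+n _ (L * L))
               (ℕP.≤-trans (ℕP.m≤m+n _ L) (ℕP.m≤m+n _ L)))

  bounded-interval : ∀ {v lo l} → Small v → lo + l ≤ M → ∀ {f} → f ∈ interval lo l → Bounded (v ≐ f)
  bounded-interval small fits f∈ with i , i≤l , refl ← ∈-interval⁻ f∈ =
    bounded-eqn small (ℕP.≤-trans (ℕP.+-monoʳ-≤ _ i≤l) fits)

  shaped-interval : ∀ {v lo l} → Small v → lo + l ≤ M → Shaped Bounded 1 (suc l) (v ≐∈ interval lo l)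
  shaped-interval {v} {lo} {l} small fits =
    shaped-mono ℕP.≤-refl (ℕP.≤-reflexive length-interval) (shaped-eqs v (interval lo l) (bounded-interval small fits))

  add-intervals :
    ∀ {π U V W lo l R₁ R₂} lo₁ l₁ lo₂ l₂ →
    zipWith ℤ._+_ U V ≡ W → lo₁ + lo₂ ≡ lo → l₁ + l₂ ≡ l → lo + l ≤ M →
    Small U → Small V → Small W → Tail R₁ → Tail R₂ →
    (U ≐∈ interval lo₁ l₁ ++ R₁) ∈≈ π → (V ≐∈ interval lo₂ l₂ ++ R₂) ∈≈ π →
    Extends C π ((W ≐∈ interval lo l ++ (R₁ ++ R₂)) ∈≈_)
  add-intervals {U = U} {V} {W} {lo} {l} {R₁} {R₂} lo₁ l₁ lo₂ l₂
                 U+V lo-sum l-sum fits small-U small-V small-W tail₁ tail₂ D₁∈ D₂∈ =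
    relax (ℕP.*-mono-≤ B≤L A≤L)
      (fmap (∈≈-resp-≈ (++⁺ʳ-≈ (R₁ ++ R₂)
                              (sum-intervals {U = U} {V} {W} {lo₁} {l₁} {lo₂} {l₂} U+V lo-sum l-sum)))
        (resolve-pairwise plus U V R₁ R₂ tail₁ tail₂
                 (bounded-interval {U} {lo₁} {l₁} small-U fits₁) (bounded-interval {V} {lo₂} {l₂} small-V fits₂)
                 bounded-sum ℕP.≤-refl short
                 D₁∈ D₂∈))
    where
    fits₁ : lo₁ + l₁ ≤ M
    fits₁ = ℕP.≤-trans (ℕP.+-mono-≤ (ℕP.m≤m+n lo₁ lo₂) (ℕP.m≤m+n l₁ l₂))
                       (subst₂ (λ a b → a + b ≤ M) (sym lo-sum) (sym l-sum) fits)
    fits₂ : lo₂ + l₂ ≤ M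
    fits₂ = ℕP.≤-trans (ℕP.+-mono-≤ (ℕP.m≤n+m lo₂ lo₁) (ℕP.m≤n+m l₂ l₁))
                       (subst₂ (λ a b → a + b ≤ M) (sym lo-sum) (sym l-sum) fits)
    length≤L : ∀ lo′ l′ → lo′ + l′ ≤ M → length (interval lo′ l′) ≤ L
    length≤L lo′ l′ fits′ =
      ℕP.≤-trans (ℕP.≤-reflexive length-interval) (s≤s (ℕP.≤-trans (ℕP.m≤n+m l′ lo′) fits′))
    A≤L = length≤L lo₁ l₁ fits₁
    B≤L = length≤L lo₂ l₂ fits₂
    short : length (interval lo₁ l₁) + length (interval lo₂ l₂) + length (interval lo₂ l₂) * length (interval lo₁ l₁)
            + L + L ≤ Lmax
    short = ℕP.+-monoˡ-≤ L (ℕP.+-monoˡ-≤ L (ℕP.+-mono-≤ (ℕP.+-mono-≤ A≤L B≤L) (ℕP.*-mono-≤ B≤L A≤L)))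
    bounded-sum : ∀ {a b} → a ∈ interval lo₁ l₁ → b ∈ interval lo₂ l₂ → Bounded ((U ≐ a) ⊕ (V ≐ b))
    bounded-sum a∈ b∈
      with i , i≤ , refl ← ∈-interval⁻ {lo₁} {l₁} a∈ | j , j≤ , refl ← ∈-interval⁻ {lo₂} {l₂} b∈ =
      bounded-eqn (subst Small (sym U+V) small-W)
        (ℕP.≤-trans (ℕP.≤-reflexive (+-interchange lo₁ i lo₂ j))
          (ℕP.≤-trans (ℕP.+-mono-≤ (ℕP.≤-reflexive lo-sum) (ℕP.≤-trans (ℕP.+-mono-≤ i≤ j≤) (ℕP.≤-reflexive l-sum)))
                      fits))

  x : ℕ → ℕ → Vec ℤ (m * n)
  x i k = box i (suc i) k (suc k)

  var≡x : ∀ {i k} (i<m : i < m) (k<n : k < n) → var (fromℕ< i<m) (fromℕ< k<n) ≡ x i k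
  var≡x i<m k<n = trans (var≡box (fromℕ< i<m) (fromℕ< k<n))
    (cong₂ (λ i k → box i (suc i) k (suc k)) (FP.toℕ-fromℕ< i<m) (FP.toℕ-fromℕ< k<n))

  pigeon<m : ∀ {i} → i ≤ n → i < m
  pigeon<m i≤n = ℕP.<-≤-trans (s≤s i≤n) n<m

  small-x : ∀ {i} k → i ≤ n → Small (x i k)
  small-x {i} k i≤n = small-box i (suc i) k (suc k) (s≤s i≤n)

  boolean-axiom : ∀ {π i k} → i ≤ n → k < n → Extends 1 π ((x i k ≐∈ interval 0 1) ∈≈_)
  boolean-axiom {i = i} {k} i≤n k<n =
    derive (boolean (combine (fromℕ< (pigeon<m i≤n)) (fromℕ< k<n))
                    (≡⇒≈ (cong (λ v → (v ≐ 0ℤ) ∷ (v ≐ 1ℤ) ∷ []) (sym (var≡x (pigeon<m i≤n) k<n)))))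
           (good (shaped-interval (small-x k i≤n) (s≤s z≤n)) (s≤s z≤n) (≤M⇒≤L (≤suc-n⇒≤M (s≤s (s≤s z≤n)))))

  hole-axiom : ∀ {π i t k} → i < t → t ≤ n → k < n → Extends 1 π (((x i k ≐ 0ℤ) ∷ (x t k ≐ 0ℤ) ∷ []) ∈≈_)
  hole-axiom {i = i} {t} {k} i<t t≤n k<n =
    derive (initial (hole (fromℕ< k<n) (subst₂ _<_ (sym (FP.toℕ-fromℕ< i<m)) (sym (FP.toℕ-fromℕ< t<m)) i<t))
                    (≡⇒≈ (cong₂ (λ u v → (u ≐ 0ℤ) ∷ (v ≐ 0ℤ) ∷ []) (sym (var≡x i<m k<n)) (sym (var≡x t<m k<n)))))
           (good (shaped-++ (single i≤n) (single t≤n)) (s≤s (s≤s z≤n)) (≤M⇒≤L (≤suc-n⇒≤M (s≤s (s≤s z≤n)))))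
    where
    i≤n = ℕP.<⇒≤ (ℕP.<-≤-trans i<t t≤n)
    i<m = pigeon<m i≤n
    t<m = pigeon<m t≤n
    single : ∀ {j} → j ≤ n → Shaped Bounded 1 1 ((x j k ≐ 0ℤ) ∷ [])
    single j≤n = shaped-interval (small-x k j≤n) z≤n

  clause : ℕ → ℕ → ℕ → Line (m * n)
  clause i j zero    = []
  clause i j (suc c) = (x i j ≐ 1ℤ) ∷ clause i (suc j) c

  ∈-clause⁻ : ∀ {i j c e} → e ∈ clause i j c → ∃[ k ] (j ≤ k × k < j + c × e ≡ (x i k ≐ 1ℤ))
  ∈-clause⁻ {j = j} {suc c} (here refl) = j , ℕP.≤-refl , ℕP.m<m+n j (s≤s z≤n) , refl
  ∈-clause⁻ {j = j} {suc c} (there e∈) with k , j<k , k< , refl ← ∈-clause⁻ e∈ =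
    k , ℕP.<⇒≤ j<k , subst (k <_) (sym (ℕP.+-suc j c)) k< , refl

  ∈-clause⁺ : ∀ {i j c k} → j ≤ k → k < j + c → (x i k ≐ 1ℤ) ∈ clause i j c
  ∈-clause⁺ {j = j} {zero} {k} j≤k k< = contradiction (subst (k <_) (ℕP.+-identityʳ j) k<) (ℕP.≤⇒≯ j≤k)
  ∈-clause⁺ {j = j} {suc c} {k} j≤k k< with ℕP.m≤n⇒m<n∨m≡n j≤k
  ... | inj₂ refl = here refl
  ... | inj₁ j<k  = there (∈-clause⁺ j<k (subst (k <_) (ℕP.+-suc j c) k<))

  length-clause : ∀ i j c → length (clause i j c) ≡ c
  length-clause i j zero    = refl
  length-clause i j (suc c) = cong suc (length-clause i (suc j) c)

  shaped-clause-lits : ∀ {i j c} → i ≤ n → j + c ≤ n → Shaped Bounded 1 c (clause i j c)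
  shaped-clause-lits {i} {j} {c} i≤n j+c≤n =
    shaped-mono ℕP.≤-refl (ℕP.≤-reflexive (length-clause i j c))
      (shaped-clause (All.tabulate bounded-lit) (All.tabulate literal))
    where
    bounded-lit : ∀ {e} → e ∈ clause i j c → Bounded e
    bounded-lit e∈ with k , _ , _ , refl ← ∈-clause⁻ e∈ = bounded-eqn (small-x k i≤n) (s≤s z≤n)
    literal : ∀ {e} → e ∈ clause i j c → IsLiteral e
    literal e∈ with k , _ , k< , refl ← ∈-clause⁻ e∈ =
      let k<n = ℕP.<-≤-trans k< j+c≤n
      in combine (fromℕ< (pigeon<m i≤n)) (fromℕ< k<n) , inj₂ (cong (_≐ 1ℤ) (sym (var≡x (pigeon<m i≤n) k<n)))

  pigeon-axiom : ∀ {π i} → i ≤ n → Extends 1 π (clause i 0 n ∈≈_)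
  pigeon-axiom {i = i} i≤n =
    derive (initial (pigeon (fromℕ< i<m)) (to , from))
           (good (shaped-clause-lits i≤n ℕP.≤-refl) (s≤s z≤n) (≤M⇒≤L (≤suc-n⇒≤M (ℕP.n≤1+n n))))
    where
    i<m = pigeon<m i≤n
    to : clause i 0 n ⊆ map (λ j → var (fromℕ< i<m) j ≐ 1ℤ) (allFin n)
    to e∈ with k , _ , k<n , refl ← ∈-clause⁻ e∈ =
      subst (_∈ map (λ j → var (fromℕ< i<m) j ≐ 1ℤ) (allFin n)) (cong (_≐ 1ℤ) (var≡x i<m k<n))
            (∈-map⁺ (λ j → var (fromℕ< i<m) j ≐ 1ℤ) (∈-allFin (fromℕ< k<n)))
    from : map (λ j → var (fromℕ< i<m) j ≐ 1ℤ) (allFin n) ⊆ clause i 0 n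
    from e∈ with j , _ , refl ← ∈-map⁻ (λ j → var (fromℕ< i<m) j ≐ 1ℤ) e∈ =
      subst (_∈ clause i 0 n)
            (cong (_≐ 1ℤ) (sym (trans (cong (var (fromℕ< i<m)) (sym (FP.fromℕ<-toℕ j (FP.toℕ<n j))))
                                      (var≡x i<m (FP.toℕ<n j)))))
            (∈-clause⁺ z≤n (FP.toℕ<n j))

  tail-interval : ∀ {v lo l} → Small v → lo + l ≤ M → Tail (v ≐∈ interval lo l)
  tail-interval {l = l} small fits =
    shaped-mono (s≤s z≤n) (s≤s (ℕP.≤-trans (ℕP.m≤n+m l _) fits)) (shaped-interval small fits)

  colSum : ℕ → ℕ → Vec ℤ (m * n)
  colSum k t = box 0 t k (suc k)

  colSum-step : ∀ k t → zipWith ℤ._+_ (colSum k t) (x t k) ≡ colSum k (suc t)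
  colSum-step k t = box-split-rows z≤n (ℕP.n≤1+n t) k (suc k)

  small-colSum : ∀ k {t} → t ≤ suc n → Small (colSum k t)
  small-colSum k {t} t≤ = small-box 0 t k (suc k) t≤

  empty-below : ∀ {π k t} s → k < n → t ≤ n → s < t →
                Extends (suc s * (1 + C)) π (((colSum k (suc s) ≐ 0ℤ) ∷ (x t k ≐ 0ℤ) ∷ []) ∈≈_)
  empty-below zero k<n t≤n 0<t = relax (s≤s z≤n) (hole-axiom 0<t t≤n k<n)
  empty-below {k = k} {t} (suc s) k<n t≤n s<t =
    relax (ℕP.≤-reflexive (ℕP.+-comm (suc s * (1 + C)) (1 + C))) (
      bind (empty-below s k<n t≤n (ℕP.<-trans (ℕP.n<1+n s) s<t)) λ π⊆ E∈ →
      bind (hole-axiom s<t t≤n k<n) λ π⊆′ H∈ →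
      fmap (∈≈-resp-≈ (++-absorbʳ λ { (here refl) → there (here refl) }))
           (add-intervals 0 0 0 0 (colSum-step k (suc s)) refl refl z≤n
                          (small-colSum k (ℕP.≤-trans (ℕP.<⇒≤ s<n) (ℕP.n≤1+n n)))
                          (small-x k (ℕP.<⇒≤ s<n)) (small-colSum k (ℕP.≤-trans s<n (ℕP.n≤1+n n)))
                          tail-x tail-x (∈≈-mono π⊆′ E∈) H∈))
    where
    s<n = ℕP.<-≤-trans s<t t≤n
    tail-x : Tail ((x t k ≐ 0ℤ) ∷ [])
    tail-x = tail-interval (small-x k t≤n) z≤n

  -- The line Σ_{i<s} x_{i,k} = 0 ∨ x_{s,k} = 0 and the Boolean axiom for x_{s,k} give
  -- Σ_{i≤s} x_{i,k} ∈ {0,1} ∨ x_{s,k} = 0; adding Σ_{i<s} x_{i,k} ∈ {0,1} to the literal x_{s,k} = 0 removes it.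
  column-prefix : ∀ {π k} t → k < n → t < suc n →
                  Extends (suc t * columnStep n) π ((colSum k (suc t) ≐∈ interval 0 1) ∈≈_)
  column-prefix zero k<n _ = relax (s≤s z≤n) (boolean-axiom z≤n k<n)
  column-prefix {k = k} (suc t) k<n (s≤s t<n) =
    relax cost (
      bind (column-prefix t k<n (ℕP.<-trans t<n (ℕP.n<1+n n))) λ π⊆₁ F∈ →
      bind (empty-below t k<n t<n (ℕP.n<1+n t)) λ π⊆₂ E∈ →
      bind (boolean-axiom t<n k<n) λ π⊆₃ B∈ →
      bind (add-intervals 0 0 0 1 (colSum-step k (suc t)) refl refl 1≤M small₁ small-xt small₂
                          (tail-interval small-xt z≤n) shaped-[] (∈≈-mono π⊆₃ E∈) (∈≈-++[]⁺ B∈)) λ π⊆₄ G∈ →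
      fmap (∈≈-resp-≈ (++-absorbʳ (λ p → p)))
           (add-intervals 0 1 0 0 (colSum-step k (suc t)) refl refl 1≤M small₁ small-xt small₂
                          shaped-[] (tail-interval small₂ 1≤M)
                          (∈≈-++[]⁺ (∈≈-mono (λ p → π⊆₄ (π⊆₃ (π⊆₂ p))) F∈))
                          (∈≈-resp-≈ (↭⇒≈ (↭P.++-comm (colSum k (suc (suc t)) ≐∈ interval 0 1) _)) G∈)))
    where
    1≤M : 0 + 1 ≤ M
    1≤M = ≤suc-n⇒≤M (s≤s z≤n)
    small₁ = small-colSum k (ℕP.≤-trans t<n (ℕP.n≤1+n n))
    small₂ = small-colSum k (s≤s t<n)
    small-xt = small-x k t<n
    cost : suc t * columnStep n + (suc t * (1 + C) + (1 + (C + C))) ≤ suc (suc t) * columnStep n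
    cost = ℕP.≤-trans (ℕP.+-monoʳ-≤ (suc t * columnStep n) (ℕP.+-monoˡ-≤ (1 + (C + C)) (ℕP.*-monoˡ-≤ (1 + C) t<n)))
                      (ℕP.≤-reflexive (ℕP.+-comm (suc t * columnStep n) (columnStep n)))

  rowSum : ℕ → ℕ → Vec ℤ (m * n)
  rowSum i j = box i (suc i) 0 j

  rowSum-step : ∀ i j → zipWith ℤ._+_ (rowSum i j) (x i j) ≡ rowSum i (suc j)
  rowSum-step i j = box-split-cols z≤n (ℕP.n≤1+n j) i (suc i)

  small-rowSum : ∀ {i} j → i ≤ n → Small (rowSum i j)
  small-rowSum {i} j i≤n = small-box i (suc i) 0 j (s≤s i≤n)

  partial-row : ℕ → ℕ → Line (m * n)
  partial-row i j = rowSum i j ≐∈ interval 0 j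

  occupied-row : ℕ → ℕ → ℕ → Line (m * n)
  occupied-row i j c = rowSum i (suc j) ≐∈ interval 1 j ++ clause i (suc j) c

  tail-row : ∀ {i} a l b c → i ≤ n → suc l + c ≤ n → b + c ≤ n →
             Tail (rowSum i a ≐∈ interval 1 l ++ clause i b c)
  tail-row {i} a l b c i≤n l+c≤n b+c≤n =
    shaped-mono ℕP.≤-refl (≤M⇒≤L (≤suc-n⇒≤M l+c≤suc-n))
      (shaped-++ (shaped-interval (small-rowSum a i≤n) (≤suc-n⇒≤M (ℕP.≤-trans (ℕP.m≤m+n (suc l) c) l+c≤suc-n)))
                 (shaped-clause-lits i≤n b+c≤n))
    where l+c≤suc-n = ℕP.≤-trans l+c≤n (ℕP.n≤1+n n)

  -- Write P_j for Σ_{k<j} x_{i,k}. The Boolean axiom for x_{i,j} turns P_j ∈ [0, j] into P_{j+1} ∈ [0, j+1].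
  -- Adding P_j ∈ [0, j] to the literal x_{i,j} = 1 gives P_{j+1} ∈ [1, j+1], and the Boolean axiom turns the
  -- remaining P_j ∈ [1, j] into P_{j+1} ∈ [1, j+1] as well.
  row-step : ∀ {π i j c} → i ≤ n → suc (suc j) + c ≡ n →
             partial-row i (suc j) ∈≈ π → occupied-row i j (suc c) ∈≈ π →
             Extends (rowStep n) π (λ π′ → partial-row i (suc (suc j)) ∈≈ π′ × occupied-row i (suc j) c ∈≈ π′)
  row-step {i = i} {j} {c} i≤n len Z∈ Y∈ =
    bind (boolean-axiom i≤n j+1<n) λ π⊆₁ B∈ →
    bind (add-intervals 0 (suc j) 0 1 (rowSum-step i (suc j)) refl (ℕP.+-comm (suc j) 1) fits
                        small-U small-V small-W shaped-[] shaped-[]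
                        (∈≈-++[]⁺ (∈≈-mono π⊆₁ Z∈)) (∈≈-++[]⁺ B∈)) λ π⊆₂ Z′∈ →
    bind (add-intervals 0 (suc j) 1 0 (rowSum-step i (suc j)) refl (ℕP.+-identityʳ (suc j)) fits
                        small-U small-V small-W shaped-[] tail-old
                        (∈≈-++[]⁺ (∈≈-mono (λ p → π⊆₂ (π⊆₁ p)) Z∈))
                        (∈≈-resp-≈ literal-first (∈≈-mono (λ p → π⊆₂ (π⊆₁ p)) Y∈))) λ π⊆₃ G∈ →
    fmap⊆ (add-intervals 1 j 0 1 (rowSum-step i (suc j)) refl (ℕP.+-comm j 1) fits
                         small-U small-V small-W tail-new shaped-[]
                         (∈≈-resp-≈ (↭⇒≈ (↭P.shifts new-range old-range)) G∈)
                         (∈≈-++[]⁺ (∈≈-mono (λ p → π⊆₃ (π⊆₂ p)) B∈))) λ π⊆₄ Y′∈ →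
    ∈≈-mono (λ p → π⊆₄ (π⊆₃ p)) (∈≈-++[]⁻ Z′∈) ,
    ∈≈-resp-≈ (≈-trans (++⁺ˡ-≈ new-range (≡⇒≈ (LP.++-identityʳ _)))
                       (++-duplicateˡ {X = new-range} {Y = clause i (suc (suc j)) c})) Y′∈
    where
    j+1<n : suc j < n
    j+1<n = ℕP.≤-trans (ℕP.m≤m+n (suc (suc j)) c) (ℕP.≤-reflexive len)
    fits : suc (suc j) ≤ M
    fits = ≤suc-n⇒≤M (ℕP.≤-trans j+1<n (ℕP.n≤1+n n))
    small-U = small-rowSum (suc j) i≤n
    small-V = small-x (suc j) i≤n
    small-W = small-rowSum (suc (suc j)) i≤n
    old-range = rowSum i (suc j) ≐∈ interval 1 j
    new-range = rowSum i (suc (suc j)) ≐∈ interval 1 (suc j)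
    tail-old = tail-row (suc j) j (suc (suc j)) c i≤n (ℕP.≤-trans (ℕP.n≤1+n _) (ℕP.≤-reflexive len))
                                                    (ℕP.≤-reflexive len)
    tail-new = tail-row (suc (suc j)) (suc j) (suc (suc j)) c i≤n (ℕP.≤-reflexive len) (ℕP.≤-reflexive len)
    literal-first : occupied-row i j (suc c) ≈ ((x i (suc j) ≐ 1ℤ) ∷ (old-range ++ clause i (suc (suc j)) c))
    literal-first = ↭⇒≈ (↭P.shift (x i (suc j) ≐ 1ℤ) old-range (clause i (suc (suc j)) c))

  row-loop : ∀ {π i} j c → i ≤ n → suc j + c ≡ n →
             partial-row i (suc j) ∈≈ π → occupied-row i j c ∈≈ π → Extends (c * rowStep n) π (occupied-row i n′ 0 ∈≈_)
  row-loop {π} {i} j zero i≤n len Z∈ Y∈ =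
    return (subst (λ j → occupied-row i j 0 ∈≈ π) (ℕP.suc-injective (trans (sym (ℕP.+-identityʳ (suc j))) len)) Y∈)
  row-loop j (suc c) i≤n len Z∈ Y∈ =
    bind (row-step i≤n len′ Z∈ Y∈) λ { π⊆ (Z′∈ , Y′∈) → row-loop (suc j) c i≤n len′ Z′∈ Y′∈ }
    where len′ = trans (sym (ℕP.+-suc (suc j) c)) len

  occupied : ∀ {π i} → i ≤ n → Extends (rowCost n) π ((rowSum i n ≐∈ interval 1 n′) ∈≈_)
  occupied i≤n =
    relax (ℕP.+-monoʳ-≤ 2 (ℕP.*-monoˡ-≤ (rowStep n) (ℕP.n≤1+n n′))) (
      bind (boolean-axiom i≤n (s≤s z≤n)) λ π⊆ Z∈ →
      bind (pigeon-axiom i≤n) λ π⊆′ Y∈ →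
      fmap ∈≈-++[]⁻ (row-loop 0 n′ i≤n refl (∈≈-mono π⊆′ Z∈) Y∈))

  module _ (S v : ℕ → Vec ℤ (m * n)) (lo l c T : ℕ)
           (S-step : ∀ t → zipWith ℤ._+_ (S t) (v t) ≡ S (suc t)) (S-base : S 1 ≡ v 0)
           (small-S : ∀ {t} → t ≤ T → Small (S t)) (small-v : ∀ {t} → t < T → Small (v t))
           (fits : T * lo + T * l ≤ M)
           (derive-v : ∀ {π t} → t < T → Extends c π ((v t ≐∈ interval lo l) ∈≈_)) where

    accumulate : ∀ {π} t → t < T → Extends (suc t * (c + C)) π ((S (suc t) ≐∈ interval (suc t * lo) (suc t * l)) ∈≈_)
    accumulate zero 0<T =
      relax (ℕP.≤-trans (ℕP.m≤m+n c C) (ℕP.m≤m+n (c + C) 0))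
        (fmap (∈≈-resp-≈ (≡⇒≈ (cong₂ _≐∈_ (sym S-base) (cong₂ interval (sym (ℕP.+-identityʳ lo)) (sym (ℕP.+-identityʳ l))))))
              (derive-v 0<T))
    accumulate (suc t) t<T =
      relax (ℕP.≤-reflexive (ℕP.+-comm (suc t * (c + C)) (c + C))) (
        bind (accumulate t (ℕP.<-trans (ℕP.n<1+n t) t<T)) λ π⊆ S∈ →
        bind (derive-v t<T) λ π⊆′ v∈ →
        fmap ∈≈-++[]⁻
          (add-intervals (suc t * lo) (suc t * l) lo l (S-step (suc t))
                         (ℕP.+-comm (suc t * lo) lo) (ℕP.+-comm (suc t * l) l)
                         (ℕP.≤-trans (ℕP.+-mono-≤ (ℕP.*-monoˡ-≤ lo t<T) (ℕP.*-monoˡ-≤ l t<T)) fits)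
                         (small-S (ℕP.<⇒≤ t<T)) (small-v t<T) (small-S t<T)
                         shaped-[] shaped-[] (∈≈-++[]⁺ (∈≈-mono π⊆′ S∈)) (∈≈-++[]⁺ v∈)))

  total : Vec ℤ (m * n)
  total = box 0 (suc n) 0 n

  count-by-holes : ∀ {π} → Extends (n * (columnCost n + C)) π ((total ≐∈ interval 0 n) ∈≈_)
  count-by-holes =
    fmap (∈≈-resp-≈ (≡⇒≈ (cong₂ (λ lo l → total ≐∈ interval lo l) (ℕP.*-zeroʳ n) (ℕP.*-identityʳ n))))
      (accumulate (λ c → box 0 (suc n) 0 c) (λ k → colSum k (suc n)) 0 1 (columnCost n) n
                  (λ c → box-split-cols z≤n (ℕP.n≤1+n c) 0 (suc n)) refl
                  (λ {c} _ → small-box 0 (suc n) 0 c ℕP.≤-refl) (λ {k} _ → small-colSum k ℕP.≤-refl)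
                  (ℕP.≤-trans (ℕP.≤-reflexive (cong₂ _+_ (ℕP.*-zeroʳ n) (ℕP.*-identityʳ n))) (≤suc-n⇒≤M (ℕP.n≤1+n n)))
                  (λ k<n → column-prefix n k<n (ℕP.n<1+n n))
                  n′ (ℕP.n<1+n n′))

  count-by-pigeons : ∀ {π} → Extends (suc n * (rowCost n + C)) π ((total ≐∈ interval (suc n) (suc n * n′)) ∈≈_)
  count-by-pigeons =
    fmap (∈≈-resp-≈ (≡⇒≈ (cong (λ lo → total ≐∈ interval lo (suc n * n′)) (ℕP.*-identityʳ (suc n)))))
      (accumulate (λ r → box 0 r 0 n) (λ i → rowSum i n) 1 n′ (rowCost n) (suc n)
                  (λ r → box-split-rows z≤n (ℕP.n≤1+n r) 0 n) refl
                  (λ {r} r≤ → small-box 0 r 0 n r≤) (λ i< → small-rowSum n (ℕP.≤-pred i<))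
                  (ℕP.≤-trans (ℕP.≤-reflexive (trans (cong (_+ suc n * n′) (ℕP.*-identityʳ (suc n))) (sym (ℕP.*-suc (suc n) n′))))
                              (ℕP.*-monoʳ-≤ (suc n) (ℕP.n≤1+n n)))
                  (λ i< → occupied (ℕP.≤-pred i<))
                  n (ℕP.n<1+n n))

  Refuted : List (Line (m * n)) → Set
  Refuted π = ∃[ π′ ] (π ≡ [] ∷ π′)

  Absurd : Eqn (m * n) → Set
  Absurd e = Bounded e × ∃[ k ] (e ≡ (zeroVec ≐ k) × k ≢ 0ℤ)

  simplify-all : ∀ {π e} Es → All Absurd (e ∷ Es) → length Es ≤ Lmax → (e ∷ Es) ∈≈ π →
                 Extends (suc (length Es)) π Refuted
  simplify-all [] ((_ , k , refl , k≢0) ∷ []) _ (D , D∈ , D≈) =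
    derive-last (simplification k k≢0 D∈ D≈ ≈-refl) shaped-[]
  simplify-all (e′ ∷ Es) ((_ , k , refl , k≢0) ∷ absurd) len (D , D∈ , D≈) =
    bind (derive (simplification k k≢0 D∈ D≈ ≈-refl)
                 (shaped-mono (s≤s z≤n) len (shaped-block zeroVec (All.map proj₁ absurd) (All.map zero-coeffs absurd))))
         λ _ L∈ → simplify-all Es absurd (ℕP.≤-trans (ℕP.n≤1+n _) len) L∈
    where
    zero-coeffs : ∀ {e} → Absurd e → coeffs e ≡ zeroVec
    zero-coeffs (_ , _ , refl , _) = refl

  small-zeroVec : Small zeroVec
  small-zeroVec = (λ z → ℕP.≤-trans (ℕP.≤-reflexive (cong ∣_∣ (VP.lookup-replicate z 0ℤ))) z≤n)
                , ℕP.≤-trans (ℕP.≤-reflexive (∥zeroVec∥₁ (m * n))) z≤n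

  M≡ : M ≡ suc n + (suc n + suc n * n′)
  M≡ = trans (ℕP.*-suc (suc n) n) (cong (suc n +_) (ℕP.*-suc (suc n) n′))

  fits-pigeons : suc n + suc n * n′ ≤ M
  fits-pigeons = ℕP.≤-trans (ℕP.m≤n+m _ (suc n)) (ℕP.≤-reflexive (sym M≡))

  bounded-difference : ∀ {a b} → a ∈ interval 0 n → b ∈ interval (suc n) (suc n * n′) →
                       Bounded ((total ≐ a) ⊖ (total ≐ b))
  bounded-difference a∈ b∈
    with i , i≤n , refl ← ∈-interval⁻ {0} {n} a∈ | j , j≤ , refl ← ∈-interval⁻ {suc n} {suc n * n′} b∈ =
    subst (λ v → Bounded (v ≐ _)) (sym (zipWith-inverseʳ total))
      (bounded-eqn small-zeroVec (ℕP.≤-trans (ℤP.∣i-j∣≤∣i∣+∣j∣ (ℤ.+ i) (ℤ.+ (suc n + j)))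
        (ℕP.≤-trans (ℕP.+-mono-≤ (ℕP.≤-trans i≤n (ℕP.n≤1+n n)) (ℕP.+-monoʳ-≤ (suc n) j≤)) (ℕP.≤-reflexive (sym M≡)))))

  absurd-difference : ∀ {e} → e ∈ pairwise minus total total (interval 0 n) (interval (suc n) (suc n * n′)) → Absurd e
  absurd-difference e∈
    with b , a , b∈ , a∈ , refl ←
         ∈-cartesianProductWith⁻ (λ b a → (total ≐ a) ⊖ (total ≐ b)) (interval (suc n) _) (interval 0 n) e∈ =
    bounded-difference a∈ b∈ , a ℤ.- b , cong (_≐ a ℤ.- b) (zipWith-inverseʳ total) , separated-intervals a∈ b∈

  counting-contradiction : ∀ {π} → (total ≐∈ interval 0 n) ∈≈ π → (total ≐∈ interval (suc n) (suc n * n′)) ∈≈ π →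
                           Extends (C + C) π Refuted
  counting-contradiction at-most-n at-least-n+1 =
    relax (ℕP.+-mono-≤ pairs≤C (ℕP.≤-trans (ℕP.≤-reflexive (length-pairwise minus total total A B)) pairs≤C)) (
      bind (resolve-pairwise minus total total [] [] (shaped-[] {k = 0} {l = 0}) (shaped-[] {k = 0} {l = 0})
                             (bounded-interval {total} {0} {n} small-total (≤suc-n⇒≤M (ℕP.n≤1+n n)))
                             (bounded-interval {total} {suc n} {suc n * n′} small-total fits-pigeons)
                             bounded-difference (s≤s (s≤s (s≤s (s≤s z≤n)))) short
                             (∈≈-++[]⁺ at-most-n) (∈≈-++[]⁺ at-least-n+1)) λ _ P∈ →
      simplify-all _ (All.tabulate absurd-difference)
        (ℕP.≤-trans (ℕP.n≤1+n _) (ℕP.≤-trans (ℕP.≤-reflexive (length-pairwise minus total total A B))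
                                              (ℕP.≤-trans pairs≤C C≤Lmax)))
        (∈≈-++[]⁻ P∈))
    where
    A = interval 0 n
    B = interval (suc n) (suc n * n′)
    small-total = small-box 0 (suc n) 0 n ℕP.≤-refl
    A≤L : length A ≤ L
    A≤L = ℕP.≤-trans (ℕP.≤-reflexive (length-interval {0} {n})) (s≤s (≤suc-n⇒≤M (ℕP.n≤1+n n)))
    B≤L : length B ≤ L
    B≤L = ℕP.≤-trans (ℕP.≤-reflexive (length-interval {suc n} {suc n * n′}))
                     (s≤s (ℕP.≤-trans (ℕP.m≤n+m _ (suc n)) fits-pigeons))
    pairs≤C : length B * length A ≤ C
    pairs≤C = ℕP.*-mono-≤ B≤L A≤L
    C≤Lmax : C ≤ Lmax
    C≤Lmax = ℕP.≤-trans (ℕP.m≤n+m C (L + L)) (ℕP.≤-trans (ℕP.m≤m+n _ L) (ℕP.m≤m+n _ L))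
    short : length A + length B + length B * length A + 0 + 0 ≤ Lmax
    short = ℕP.+-mono-≤ (ℕP.+-mono-≤ (ℕP.+-mono-≤ (ℕP.+-mono-≤ A≤L B≤L) pairs≤C) z≤n) z≤n

  refutation : Extends (refutationLength n) [] Refuted
  refutation =
    bind count-by-holes λ _ at-most-n →
    bind count-by-pigeons λ π⊆ at-least-n+1 →
    counting-contradiction (∈≈-mono π⊆ at-most-n) at-least-n+1

  php-refutation : Σ (List (Line (m * n))) λ π →
    Refutation (PHP m n) π × All (R0Line 1 8) π × proofSize π ≤ refutationSize n
  php-refutation = from-extension (run refutation [])
    where
    r0 : ∀ {X} → Good X → R0Line 1 8 X
    r0 shaped = (λ e∈ → Bounded.unit-coeffs (All.lookup all-ok e∈)) , parts , concat-↭ , few-parts , good-parts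
      where open Shaped shaped
    line-size : ∀ {X} → Good X → lineSize X ≤ Lmax * E
    line-size {X} shaped = ℕP.≤-trans (lineSize≤ E X (All.map Bounded.small all-ok)) (ℕP.*-monoˡ-≤ E short)
      where open Shaped shaped
    from-extension : (Σ (List (Line (m * n))) λ new → length new ≤ refutationLength n × All Good new ×
                        Derivation (PHP m n) (new ++ []) × Refuted (new ++ [])) →
                     Σ (List (Line (m * n))) λ π →
                       Refutation (PHP m n) π × All (R0Line 1 8) π × proofSize π ≤ refutationSize n
    from-extension (new , length≤ , good , derivation , π′ , last) =
      new ++ [] , (π′ , last , derivation) , All.map r0 (AllP.++⁺ good []) ,
      ℕP.≤-trans (proofSize≤ (Lmax * E) (new ++ []) (All.map line-size (AllP.++⁺ good [])))
                 (ℕP.*-monoˡ-≤ (Lmax * E) (ℕP.≤-trans (ℕP.≤-reflexive (cong length (LP.++-identityʳ new))) length≤))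

poly-refutationSize : PolyBounded (λ n′ → refutationSize (suc n′))
poly-refutationSize = poly-* total (poly-* Lmax E)
  where
  suc′ : ∀ {f} → PolyBounded f → PolyBounded (λ x → suc (f x))
  suc′ = poly-+ (poly-const 1)
  n = suc′ poly-id
  M = poly-* (suc′ n) (suc′ n)
  E = poly-+ (poly-* (suc′ n) n) M
  L = suc′ M
  Lmax = poly-+ (poly-+ (poly-+ (poly-+ L L) (poly-* L L)) L) L
  C = poly-* L L
  column = poly-* (suc′ n) (poly-+ (poly-* n (suc′ C)) (suc′ (poly-+ C C)))
  row = poly-+ (poly-const 2) (poly-* n (suc′ (poly-+ C (poly-+ C C))))
  total = poly-+ (poly-* n (poly-+ column C)) (poly-+ (poly-* (suc′ n) (poly-+ row C)) (poly-+ C C))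

theorem6p4 : ∃[ B ] ∃[ K ] ∃[ c ] ∃[ d ] ((m n : ℕ) → n < m →
               Σ (List (Line (m * n))) λ π →
                 Refutation (PHP m n) π × All (R0Line B K) π × proofSize π ≤ c * n ^ d + c)
theorem6p4 = from-bound poly-refutationSize
  where
  from-bound : PolyBounded (λ n′ → refutationSize (suc n′)) →
               ∃[ B ] ∃[ K ] ∃[ c ] ∃[ d ] ((m n : ℕ) → n < m →
                 Σ (List (Line (m * n))) λ π →
                   Refutation (PHP m n) π × All (R0Line B K) π × proofSize π ≤ c * n ^ d + c)
  from-bound (c , d , size≤) = 1 , 8 , c , d , refute
    where
    refute : (m n : ℕ) → n < m → Σ (List (Line (m * n))) λ π →
             Refutation (PHP m n) π × All (R0Line 1 8) π × proofSize π ≤ c * n ^ d + c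
    -- With no holes, the pigeon axiom of pigeon 0 is already the empty disjunction.
    refute (suc m) zero _ = [] ∷ [] , ([] , refl , [] ▷ initial (pigeon F.zero) ≈-refl) ,
                            ((λ ()) , [] , ↭-refl , z≤n , []) ∷ [] , z≤n
    refute m (suc n′) n<m = weaken-bound (Pigeonhole.php-refutation m n′ n<m)
      where
      weaken-bound : (Σ (List (Line (m * suc n′))) λ π → Refutation (PHP m (suc n′)) π × All (R0Line 1 8) π ×
                        proofSize π ≤ refutationSize (suc n′)) →
                     Σ (List (Line (m * suc n′))) λ π → Refutation (PHP m (suc n′)) π × All (R0Line 1 8) π ×
                        proofSize π ≤ c * suc n′ ^ d + c
      weaken-bound (π , refutation , r0 , size) =
        π , refutation , r0 , ℕP.≤-trans size (ℕP.≤-trans (size≤ n′) (ℕP.m≤m+n _ c))
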